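{- For all integers $n\geq a\geq b\geq 0$, there exist polynomials $p_0(t),\dots,p_a(t)\in\mathbb{Z}[t]$ such that for every prime power $q$ and every $T\in M_n(\mathbb{F}_q)$, \[ \bigl|\{W\subseteq \mathbb{F}_q^n : \dim W=a,\ \dim(W\cap T^{ -1}W)=b\}\bigr| = \sum_{j=0}^a p_j(q)X^T_j, \] where $X^T_j$ is the number of $j$-dimensional $T$-invariant subspaces of $\mathbb{F}_q^n$.
   Context: $T^{ -1}W=\{v\in\mathbb{F}_q^n: Tv\in W\}$ denotes the preimage of $W$ under $T$. A subspace $W$ is $T$-invariant if $TW\subseteq W$. -}

module Defs where

open import Level using (0ℓ)
open import Data.Nat as ℕ using (ℕ; zero; suc)
open import Data.Integer as ℤ using (ℤ)
open import Data.Fin using (Fin)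
open import Data.Vec using (Vec; []; _∷_; lookup; tabulate; zipWith; replicate; foldr)
open import Data.List using (List)
import Data.List as List
open import Data.Bool using (Bool; true; _∧_)
open import Data.Product using (Σ; _×_; ∃; ∃-syntax; _,_)
open import Relation.Binary.PropositionalEquality using (_≡_; _≢_)
open import Algebra.Structures using (IsCommutativeRing)
open import Function.Bundles using (_↔_; _⇔_)

-- Quantifying over all such fields is the same as quantifying over all
-- prime powers q and F_q (finite fields have prime-power order, exist
-- for every prime power and are unique up to isomorphism).

record FiniteField : Set₁ where
  infixl 7 _*_
  infixl 6 _+_
  field
    Carrier : Set
    _+_ _*_ : Carrier → Carrier → Carrier
    -_      : Carrier → Carrier
    0# 1#   : Carrier
    isCommutativeRing : IsCommutativeRing _≡_ _+_ _*_ -_ 0# 1#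
    0≢1     : 0# ≢ 1#
    inverse : ∀ x → x ≢ 0# → ∃[ y ] (x * y ≡ 1#)
    size    : ℕ
    enum    : Fin size ↔ Carrier

module LinAlg (F : FiniteField) where
  open FiniteField F

  Vector : ℕ → Set
  Vector n = Vec Carrier n

  Matrix : ℕ → Set
  Matrix n = Fin n → Fin n → Carrier

  zeroV : ∀ {n} → Vector n
  zeroV = replicate _ 0#

  _+ᵥ_ : ∀ {n} → Vector n → Vector n → Vector n
  _+ᵥ_ = zipWith _+_

  _·ᵥ_ : ∀ {n} → Carrier → Vector n → Vector n
  c ·ᵥ v = Data.Vec.map (c *_) v

  sumF : ∀ {m} → Vec Carrier m → Carrier
  sumF = foldr _ _+_ 0#

  apply : ∀ {n} → Matrix n → Vector n → Vector n
  apply T v = tabulate λ i → sumF (tabulate λ j → T i j * lookup v j)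

  lincomb : ∀ {n d} → Vec Carrier d → Vec (Vector n) d → Vector n
  lincomb []       []        = zeroV
  lincomb (c ∷ cs) (v ∷ vs)  = (c ·ᵥ v) +ᵥ lincomb cs vs

  LinIndep : ∀ {n d} → Vec (Vector n) d → Set
  LinIndep {d = d} vs = ∀ (c : Vec Carrier d) → lincomb c vs ≡ zeroV → ∀ i → lookup c i ≡ 0#

  SubsetV : ℕ → Set
  SubsetV n = Vector n → Bool

  _∈ˢ_ : ∀ {n} → Vector n → SubsetV n → Set
  v ∈ˢ W = W v ≡ true

  _≈ˢ_ : ∀ {n} → SubsetV n → SubsetV n → Set
  W ≈ˢ W′ = ∀ v → W v ≡ W′ v

  IsSubspace : ∀ {n} → SubsetV n → Set
  IsSubspace W = (zeroV ∈ˢ W)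
               × (∀ u v → u ∈ˢ W → v ∈ˢ W → (u +ᵥ v) ∈ˢ W)
               × (∀ c v → v ∈ˢ W → (c ·ᵥ v) ∈ˢ W)

  HasDim : ∀ {n} → SubsetV n → ℕ → Set
  HasDim {n} W d = Σ (Vec (Vector n) d) λ vs →
                     LinIndep vs × (∀ v → v ∈ˢ W ⇔ (∃[ c ] (lincomb c vs ≡ v)))

  preimage : ∀ {n} → Matrix n → SubsetV n → SubsetV n
  preimage T W v = W (apply T v)

  _∩ˢ_ : ∀ {n} → SubsetV n → SubsetV n → SubsetV n
  (W ∩ˢ W′) v = W v ∧ W′ v

  IsInvariant : ∀ {n} → Matrix n → SubsetV n → Set
  IsInvariant T W = ∀ v → v ∈ˢ W → apply T v ∈ˢ W

  -- "the set of subsets W of F^n with property P has exactly N elements",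
  -- subsets being identified up to extensional equality.
  HasCount : ∀ {n} → (SubsetV n → Set) → ℕ → Set
  HasCount {n} P N =
    Σ (Vec (SubsetV n) N) λ Ws →
        (∀ i → P (lookup Ws i))
      × (∀ i j → lookup Ws i ≈ˢ lookup Ws j → i ≡ j)
      × (∀ W → P W → ∃[ i ] (W ≈ˢ lookup Ws i))

-- Integer polynomials as coefficient lists (constant term first).

Poly : Set
Poly = List ℤ

evalPoly : Poly → ℤ → ℤ
evalPoly p t = List.foldr (λ c acc → c ℤ.+ t ℤ.* acc) (ℤ.+ 0) p

sumℤ : ∀ {m} → (Fin m → ℤ) → ℤ
sumℤ {zero}  f = ℤ.+ 0
sumℤ {suc m} f = f Fin.zero ℤ.+ sumℤ (λ i → f (Fin.suc i))
  where import Data.Fin as Fin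

-- Write σ(a,b) for the number of a-dimensional W with dim (W ∩ T⁻¹W) = b, so that X_j = σ(j,j).
-- For U of dimension c with dim (U ∩ T⁻¹U) = e, we have U ⊆ W ∩ T⁻¹W iff U + TU ⊆ W, and
-- dim (U + TU) = 2c - e (extend a basis of U ∩ T⁻¹U to one of U; the images of the new vectors,
-- together with U, form a basis of U + TU).  Counting the pairs U ⊆ W ∩ T⁻¹W in two ways gives
--   Σ_b σ(a,b) [b choose c]_q = Σ_e σ(c,e) [n-(2c-e) choose a-(2c-e)]_q.
-- As [c choose c]_q = 1 and [b choose c]_q = 0 for b < c, this expresses σ(a,c), c < a, through
-- σ(c,-) and the σ(a,b) with b > c, and induction yields the polynomials.  Subspaces are handled
-- through their ordered bases: an a-dimensional space has Π_{i<a} (q^a - q^i) of them, so each count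
-- of subspaces is a count of independent tuples divided by that number.

module Submission where

open import Defs

open import Algebra.Bundles using (CommutativeRing)
open import Data.Bool as Bool using (Bool; true; false; _∧_; _∨_; not; if_then_else_)
import Data.Bool.Properties as BoolP
open import Data.Empty using (⊥-elim)
open import Data.Fin as Fin using (Fin; zero; suc; toℕ)
import Data.Fin.Properties as FinP
open import Data.List as List using (List; []; _∷_)
open import Data.List.Membership.Propositional using (_∈_)
open import Data.List.Membership.Propositional.Properties using (∈-upTo⁻)
import Data.List.Properties as ListP
open import Data.List.Relation.Unary.Any using (here; there)
open import Data.Nat as ℕ using (ℕ; zero; suc; _≤_; _<_; z≤n; s≤s; _∸_; _^_)
import Data.Nat.Properties as ℕP
open import Data.Product using (Σ; _×_; _,_; ∃-syntax; proj₁; proj₂)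
open import Data.Sum using (_⊎_; inj₁; inj₂)
open import Data.Vec as Vec using (Vec; []; _∷_; lookup; _++_)
import Data.Vec.Properties as VecP
open import Function using (_∘_)
open import Function.Bundles using (_⇔_; mk⇔; Equivalence; Inverse)
open import Level using (0ℓ)
open import Relation.Binary.Definitions using (DecidableEquality; tri<; tri≈; tri>)
open import Relation.Binary.PropositionalEquality
open import Relation.Nullary using (Dec; yes; no; ¬_; does)
open import Relation.Nullary.Decidable using (does-⇔; dec-true; dec-false; map′)

∧-true⁻ : ∀ {a b} → a ∧ b ≡ true → a ≡ true × b ≡ true
∧-true⁻ {true} {true} _ = refl , refl

∧-true⁺ : ∀ {a b} → a ≡ true → b ≡ true → a ∧ b ≡ true
∧-true⁺ refl refl = refl

not-true⁻ : ∀ {a} → not a ≡ true → a ≡ false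
not-true⁻ {false} _ = refl

true≢false : ∀ {a} → a ≡ true → a ≢ false
true≢false refl ()

bool-ext : ∀ {a b : Bool} → (a ≡ true → b ≡ true) → (b ≡ true → a ≡ true) → a ≡ b
bool-ext {true}          a⇒b _   = sym (a⇒b refl)
bool-ext {false} {true}  _   b⇒a = b⇒a refl
bool-ext {false} {false} _   _   = refl

does-true⁻ : {P : Set} (p? : Dec P) → does p? ≡ true → P
does-true⁻ (yes p) _ = p

upTo-suc : ∀ n → List.upTo (suc n) ≡ 0 ∷ List.map suc (List.upTo n)
upTo-suc n = cong (0 ∷_) (sym (ListP.map-upTo suc n))

does-suc-≟ : ∀ k j → does (suc k ℕ.≟ suc j) ≡ does (k ℕ.≟ j)
does-suc-≟ k j = does-⇔ (mk⇔ ℕP.suc-injective (cong suc)) (suc k ℕ.≟ suc j) (k ℕ.≟ j)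

module ListSums where
  open import Data.Nat using (_+_; _*_)
  open ℕP

  𝟙 : Bool → ℕ
  𝟙 true  = 1
  𝟙 false = 0

  sumL : {A : Set} → (A → ℕ) → List A → ℕ
  sumL f []       = 0
  sumL f (x ∷ xs) = f x + sumL f xs

  count : {A : Set} → (A → Bool) → List A → ℕ
  count p = sumL (λ x → 𝟙 (p x))

  module _ {A : Set} where

    sumL-cong : ∀ {f g : A → ℕ} (L : List A) → (∀ x → f x ≡ g x) → sumL f L ≡ sumL g L
    sumL-cong []      e = refl
    sumL-cong (x ∷ L) e = cong₂ _+_ (e x) (sumL-cong L e)

    sumL-+ : ∀ (f g : A → ℕ) (L : List A) → sumL (λ x → f x + g x) L ≡ sumL f L + sumL g L
    sumL-+ f g []      = refl
    sumL-+ f g (x ∷ L) rewrite sumL-+ f g L = +-interchange (f x) (g x) _ _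
      where open import Algebra.Properties.CommutativeSemigroup +-commutativeSemigroup
              renaming (interchange to +-interchange)

    sumL-*ʳ : ∀ (f : A → ℕ) k (L : List A) → sumL (λ x → f x * k) L ≡ sumL f L * k
    sumL-*ʳ f k []      = refl
    sumL-*ʳ f k (x ∷ L) rewrite sumL-*ʳ f k L = sym (*-distribʳ-+ k (f x) _)

    sumL-zero : ∀ (f : A → ℕ) (L : List A) → (∀ x → f x ≡ 0) → sumL f L ≡ 0
    sumL-zero f []      e = refl
    sumL-zero f (x ∷ L) e rewrite e x = sumL-zero f L e

    sumL-++ : ∀ (f : A → ℕ) (L M : List A) → sumL f (L List.++ M) ≡ sumL f L + sumL f M
    sumL-++ f []      M = refl
    sumL-++ f (x ∷ L) M rewrite sumL-++ f L M = sym (+-assoc (f x) _ _)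

    sumL-indicator : ∀ (p : A → Bool) (f : A → ℕ) k (L : List A) →
      (∀ x → p x ≡ true → f x ≡ k) → (∀ x → p x ≡ false → f x ≡ 0) → sumL f L ≡ count p L * k
    sumL-indicator p f k []      h₁ h₀ = refl
    sumL-indicator p f k (x ∷ L) h₁ h₀ with p x in px
    ... | true  rewrite h₁ x px | sumL-indicator p f k L h₁ h₀ = refl
    ... | false rewrite h₀ x px = sumL-indicator p f k L h₁ h₀

    count-cong : ∀ {p r : A → Bool} (L : List A) → (∀ x → p x ≡ r x) → count p L ≡ count r L
    count-cong L e = sumL-cong L (λ x → cong 𝟙 (e x))

    count-none : ∀ (p : A → Bool) (L : List A) → (∀ x → p x ≡ false) → count p L ≡ 0
    count-none p L e = sumL-zero _ L (λ x → cong 𝟙 (e x))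

    count-∧-split : ∀ (p r : A → Bool) (L : List A) →
      count p L ≡ count (λ x → p x ∧ r x) L + count (λ x → p x ∧ not (r x)) L
    count-∧-split p r L = trans (sumL-cong L (λ x → sym (split (p x) (r x)))) (sumL-+ _ _ L)
      where
      split : ∀ a b → 𝟙 (a ∧ b) + 𝟙 (a ∧ not b) ≡ 𝟙 a
      split true  true  = refl
      split true  false = refl
      split false b     = refl

    count-∨-disjoint : ∀ (p r : A → Bool) (L : List A) → (∀ x → p x ∧ r x ≡ false) →
      count (λ x → p x ∨ r x) L ≡ count p L + count r L
    count-∨-disjoint p r L disjoint = trans (sumL-cong L pointwise) (sumL-+ _ _ L)
      where
      pointwise : ∀ x → 𝟙 (p x ∨ r x) ≡ 𝟙 (p x) + 𝟙 (r x)
      pointwise x with p x | r x | disjoint x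
      ... | true  | false | _ = refl
      ... | false | _     | _ = refl

    count-pos⇒∃ : ∀ (p : A → Bool) (L : List A) → 0 < count p L → ∃[ x ] (x ∈ L × p x ≡ true)
    count-pos⇒∃ p (x ∷ L) pos with p x in px
    ... | true  = x , here refl , px
    ... | false with count-pos⇒∃ p L pos
    ... | y , y∈L , py = y , there y∈L , py

    count-true≡length : (L : List A) → count (λ _ → true) L ≡ List.length L
    count-true≡length []      = refl
    count-true≡length (x ∷ L) = cong suc (count-true≡length L)

    count-mono : ∀ (p r : A → Bool) (L : List A) → (∀ x → p x ≡ true → r x ≡ true) → count p L ≤ count r L
    count-mono p r []      p⊆r = z≤n
    count-mono p r (x ∷ L) p⊆r with p x in px
    ... | true rewrite p⊆r x px = s≤s (count-mono p r L p⊆r)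
    ... | false = +-mono-≤ z≤n (count-mono p r L p⊆r)

    count-mono-< : ∀ (p r : A → Bool) {L : List A} {x : A} → (∀ y → p y ≡ true → r y ≡ true) →
      x ∈ L → p x ≡ false → r x ≡ true → count p L < count r L
    count-mono-< p r {_ ∷ L} p⊆r (here refl) px rx rewrite px | rx = s≤s (count-mono p r L p⊆r)
    count-mono-< p r {y ∷ L} p⊆r (there x∈L) px rx with p y in py
    ... | true rewrite p⊆r y py = s≤s (count-mono-< p r p⊆r x∈L px rx)
    ... | false = ≤-trans (count-mono-< p r p⊆r x∈L px rx) (m≤n+m _ (𝟙 (r y)))

    count-≡⇒⊇ : ∀ (p r : A → Bool) (L : List A) → (∀ x → p x ≡ true → r x ≡ true) →
      count p L ≡ count r L → ∀ x → x ∈ L → r x ≡ true → p x ≡ true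
    count-≡⇒⊇ p r L p⊆r same x x∈L rx with p x in px
    ... | true  = refl
    ... | false = ⊥-elim (<-irrefl same (count-mono-< p r p⊆r x∈L px rx))

  sumL-swap : {A B : Set} (f : A → B → ℕ) (L : List A) (M : List B) →
    sumL (λ x → sumL (f x) M) L ≡ sumL (λ y → sumL (λ x → f x y) L) M
  sumL-swap f []      M = sym (sumL-zero _ M (λ _ → refl))
  sumL-swap f (x ∷ L) M rewrite sumL-swap f L M = sym (sumL-+ (f x) _ M)

  sumL-map : {A B : Set} (f : B → ℕ) (g : A → B) (L : List A) → sumL f (List.map g L) ≡ sumL (λ x → f (g x)) L
  sumL-map f g []      = refl
  sumL-map f g (x ∷ L) rewrite sumL-map f g L = refl

  sumL-concat : {B : Set} (f : B → ℕ) (Ls : List (List B)) → sumL f (List.concat Ls) ≡ sumL (sumL f) Ls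
  sumL-concat f []       = refl
  sumL-concat f (L ∷ Ls) rewrite sumL-++ f L (List.concat Ls) | sumL-concat f Ls = refl

  vecsOver : {A : Set} → List A → (k : ℕ) → List (Vec A k)
  vecsOver L zero    = [] ∷ []
  vecsOver L (suc k) = List.concatMap (λ y → List.map (y ∷_) (vecsOver L k)) L

  sumL-vecsOver : {A : Set} (L : List A) (k : ℕ) (f : Vec A (suc k) → ℕ) →
    sumL f (vecsOver L (suc k)) ≡ sumL (λ y → sumL (λ xs → f (y ∷ xs)) (vecsOver L k)) L
  sumL-vecsOver L k f = trans (sumL-concat f (List.map _ L))
    (trans (sumL-map (sumL f) _ L) (sumL-cong L (λ y → sumL-map f (y ∷_) (vecsOver L k))))

  count-vecsOver : ∀ {A : Set} (L : List A) k → count (λ _ → true) (vecsOver L k) ≡ count (λ _ → true) L ^ k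
  count-vecsOver L zero    = refl
  count-vecsOver L (suc k) = trans (sumL-vecsOver L k _)
    (trans (sumL-cong L (λ _ → count-vecsOver L k)) (sumL-indicator (λ _ → true) _ _ L (λ _ _ → refl) (λ _ ())))

  Enumerates : {A : Set} → DecidableEquality A → List A → Set
  Enumerates _≟_ L = ∀ x → count (λ y → does (y ≟ x)) L ≡ 1

  module _ {A : Set} (_≟_ : DecidableEquality A) where

    enumerates⇒∈ : ∀ {L} → Enumerates _≟_ L → ∀ x → x ∈ L
    enumerates⇒∈ {L} en x with count-pos⇒∃ _ L (≤-reflexive (sym (en x)))
    ... | y , y∈L , y≡x with y ≟ x
    ... | yes refl = y∈L

    sumL-point : ∀ {L} → Enumerates _≟_ L → (f : A → ℕ) (x : A) → (∀ y → y ≢ x → f y ≡ 0) → sumL f L ≡ f x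
    sumL-point {L} en f x outside =
      trans (sumL-cong L pointwise) (trans (sumL-*ʳ _ (f x) L) (trans (cong (_* f x) (en x)) (+-identityʳ _)))
      where
      pointwise : ∀ y → f y ≡ 𝟙 (does (y ≟ x)) * f x
      pointwise y with y ≟ x
      ... | yes refl = sym (+-identityʳ _)
      ... | no y≢x   = outside y y≢x

    vecsOver-enumerates : ∀ {L} → Enumerates _≟_ L → ∀ k → Enumerates (VecP.≡-dec _≟_) (vecsOver L k)
    vecsOver-enumerates en zero    []       = refl
    vecsOver-enumerates {L} en (suc k) (x ∷ xs) =
      trans (sumL-vecsOver L k (λ ys → 𝟙 (does (ys ≟ᵥ (x ∷ xs)))))
        (trans (sumL-point {L} en _ x other-head)
          (trans (count-cong (vecsOver L k) same-head) (vecsOver-enumerates en k xs)))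
      where
      _≟ᵥ_ : ∀ {m} → DecidableEquality (Vec A m)
      _≟ᵥ_ = VecP.≡-dec _≟_
      same-head : ∀ ys → does ((x ∷ ys) ≟ᵥ (x ∷ xs)) ≡ does (ys ≟ᵥ xs)
      same-head ys = does-⇔ (mk⇔ VecP.∷-injectiveʳ (cong (x ∷_))) ((x ∷ ys) ≟ᵥ (x ∷ xs)) (ys ≟ᵥ xs)
      other-head : ∀ y → y ≢ x → count (λ ys → does ((y ∷ ys) ≟ᵥ (x ∷ xs))) (vecsOver L k) ≡ 0
      other-head y y≢x = count-none _ (vecsOver L k) λ ys → dec-false ((y ∷ ys) ≟ᵥ (x ∷ xs)) (y≢x ∘ VecP.∷-injectiveˡ)

  sumL-upTo-suc : ∀ (f : ℕ → ℕ) B → sumL f (List.upTo (suc B)) ≡ f 0 + sumL (f ∘ suc) (List.upTo B)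
  sumL-upTo-suc f B = trans (cong (sumL f) (upTo-suc B)) (cong (f 0 +_) (sumL-map f suc (List.upTo B)))

  sumL-upTo-point : ∀ B k (g : ℕ → ℕ) → k < B → sumL (λ b → 𝟙 (does (k ℕ.≟ b)) * g b) (List.upTo B) ≡ g k
  sumL-upTo-point (suc B) zero g _ = begin
    sumL (λ b → 𝟙 (does (0 ℕ.≟ b)) * g b) (List.upTo (suc B)) ≡⟨ sumL-upTo-suc (λ b → 𝟙 (does (0 ℕ.≟ b)) * g b) B ⟩
    g 0 + 0 + sumL (λ _ → 0) (List.upTo B)                  ≡⟨ cong₂ _+_ (+-identityʳ (g 0)) (sumL-zero _ (List.upTo B) (λ _ → refl)) ⟩
    g 0 + 0                                                   ≡⟨ +-identityʳ (g 0) ⟩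
    g 0 ∎
    where open ≡-Reasoning
  sumL-upTo-point (suc B) (suc k) g (s≤s k<B) = begin
    sumL (λ b → 𝟙 (does (suc k ℕ.≟ b)) * g b) (List.upTo (suc B))
      ≡⟨ sumL-upTo-suc (λ b → 𝟙 (does (suc k ℕ.≟ b)) * g b) B ⟩
    sumL (λ b → 𝟙 (does (suc k ℕ.≟ suc b)) * g (suc b)) (List.upTo B)
      ≡⟨ sumL-cong (List.upTo B) (λ b → cong (λ z → 𝟙 z * g (suc b)) (does-suc-≟ k b)) ⟩
    sumL (λ b → 𝟙 (does (k ℕ.≟ b)) * g (suc b)) (List.upTo B)
      ≡⟨ sumL-upTo-point B k (g ∘ suc) k<B ⟩
    g (suc k) ∎
    where open ≡-Reasoning

  sumL-byValue : ∀ {X : Set} (L : List X) (p : X → Bool) (d : X → ℕ) (g : ℕ → ℕ) B → (∀ x → p x ≡ true → d x < B) →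
    sumL (λ x → 𝟙 (p x) * g (d x)) L ≡ sumL (λ b → count (λ x → p x ∧ does (d x ℕ.≟ b)) L * g b) (List.upTo B)
  sumL-byValue L p d g B d<B = sym (begin
    sumL (λ b → count (λ x → p x ∧ does (d x ℕ.≟ b)) L * g b) (List.upTo B)
      ≡⟨ sumL-cong (List.upTo B) (λ b → sym (sumL-*ʳ _ (g b) L)) ⟩
    sumL (λ b → sumL (λ x → 𝟙 (p x ∧ does (d x ℕ.≟ b)) * g b) L) (List.upTo B)
      ≡⟨ sumL-swap (λ b x → 𝟙 (p x ∧ does (d x ℕ.≟ b)) * g b) (List.upTo B) L ⟩
    sumL (λ x → sumL (λ b → 𝟙 (p x ∧ does (d x ℕ.≟ b)) * g b) (List.upTo B)) L
      ≡⟨ sumL-cong L at-value ⟩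
    sumL (λ x → 𝟙 (p x) * g (d x)) L ∎)
    where
    open ≡-Reasoning
    at-value : ∀ x → sumL (λ b → 𝟙 (p x ∧ does (d x ℕ.≟ b)) * g b) (List.upTo B) ≡ 𝟙 (p x) * g (d x)
    at-value x with p x in px
    ... | true  = trans (sumL-upTo-point B (d x) g (d<B x px)) (sym (+-identityʳ _))
    ... | false = sumL-zero _ (List.upTo B) (λ _ → refl)

module QArithmetic (Q : ℕ) where
  open import Data.Nat using (_+_; _*_)
  open import Data.Nat.Tactic.RingSolver using (solve-∀)
  open ℕP
  open ≡-Reasoning

  qInt : ℕ → ℕ
  qInt zero    = 0
  qInt (suc j) = 1 + Q * qInt j

  gauss : ℕ → ℕ → ℕ
  gauss m       zero    = 1
  gauss zero    (suc k) = 0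
  gauss (suc m) (suc k) = gauss m k + Q ^ suc k * gauss m (suc k)

  qFalling : ℕ → ℕ → ℕ
  qFalling m zero    = 1
  qFalling m (suc k) = qFalling m k * qInt (m ∸ k)

  qScale : ℕ → ℕ
  qScale zero    = 1
  qScale (suc k) = qScale k * (Q ^ k * (Q ∸ 1))

  -- For Q = |F|: the number of ways to extend an independent s-tuple in an
  -- r-dimensional space by k further vectors to an independent tuple.
  extensions : ℕ → ℕ → ℕ → ℕ
  extensions r s zero    = 1
  extensions r s (suc k) = extensions r s k * (Q ^ r ∸ Q ^ (k + s))

  bases : ℕ → ℕ
  bases a = extensions a 0 a

  qInt-+ : ∀ j l → qInt (j + l) ≡ qInt j + Q ^ j * qInt l
  qInt-+ zero    l = sym (+-identityʳ (qInt l))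
  qInt-+ (suc j) l = begin
    1 + Q * qInt (j + l)                ≡⟨ cong (λ z → 1 + Q * z) (qInt-+ j l) ⟩
    1 + Q * (qInt j + Q ^ j * qInt l)   ≡⟨ distribute Q (qInt j) (Q ^ j) (qInt l) ⟩
    1 + Q * qInt j + Q * Q ^ j * qInt l ∎
    where
    distribute : ∀ Q a b c → 1 + Q * (a + b * c) ≡ 1 + Q * a + Q * b * c
    distribute = solve-∀

  qFalling-suc : ∀ m k → qFalling (suc m) (suc k) ≡ qInt (suc m) * qFalling m k
  qFalling-suc m zero    = trans (*-identityˡ _) (sym (*-identityʳ _))
  qFalling-suc m (suc k) rewrite qFalling-suc m k = *-assoc (qInt (suc m)) (qFalling m k) (qInt (m ∸ k))

  qFalling-vanishes : ∀ m k → m < k → qFalling m k ≡ 0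
  qFalling-vanishes m (suc k) m<1+k with m ≟ k
  ... | yes refl rewrite n∸n≡0 m = *-zeroʳ (qFalling m m)
  ... | no m≢k rewrite qFalling-vanishes m k (≤∧≢⇒< (≤-pred m<1+k) m≢k) = refl

  gauss-vanishes : ∀ b c → b < c → gauss b c ≡ 0
  gauss-vanishes zero    (suc c) b<c       = refl
  gauss-vanishes (suc b) (suc c) (s≤s b<c)
    rewrite gauss-vanishes b c b<c | gauss-vanishes b (suc c) (m≤n⇒m≤1+n b<c) = *-zeroʳ (Q ^ suc c)

  gauss-diag : ∀ c → gauss c c ≡ 1
  gauss-diag zero    = refl
  gauss-diag (suc c) rewrite gauss-diag c | gauss-vanishes c (suc c) ≤-refl = cong suc (*-zeroʳ (Q ^ suc c))

  gauss*qFalling : ∀ m k → gauss m k * qFalling k k ≡ qFalling m k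
  gauss*qFalling m       zero    = refl
  gauss*qFalling zero    (suc k) = sym (qFalling-vanishes 0 (suc k) (s≤s z≤n))
  gauss*qFalling (suc m) (suc k) = begin
    (gauss m k + Q ^ suc k * gauss m (suc k)) * qFalling (suc k) (suc k)
      ≡⟨ cong ((gauss m k + Q ^ suc k * gauss m (suc k)) *_) (qFalling-suc k k) ⟩
    (gauss m k + Q ^ suc k * gauss m (suc k)) * (qInt (suc k) * qFalling k k)
      ≡⟨ regroup (gauss m k) (Q ^ suc k) (gauss m (suc k)) (qInt (suc k)) (qFalling k k) ⟩
    gauss m k * qFalling k k * qInt (suc k) + Q ^ suc k * (gauss m (suc k) * (qInt (suc k) * qFalling k k))
      ≡⟨ cong₂ (λ x y → x * qInt (suc k) + Q ^ suc k * (gauss m (suc k) * y))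
               (gauss*qFalling m k) (sym (qFalling-suc k k)) ⟩
    qFalling m k * qInt (suc k) + Q ^ suc k * (gauss m (suc k) * qFalling (suc k) (suc k))
      ≡⟨ cong (λ y → qFalling m k * qInt (suc k) + Q ^ suc k * y) (gauss*qFalling m (suc k)) ⟩
    qFalling m k * qInt (suc k) + Q ^ suc k * (qFalling m k * qInt (m ∸ k))
      ≡⟨ factorOut (qFalling m k) (qInt (suc k)) (Q ^ suc k) (qInt (m ∸ k)) ⟩
    qFalling m k * (qInt (suc k) + Q ^ suc k * qInt (m ∸ k))
      ≡⟨ qInt-split ⟩
    qInt (suc m) * qFalling m k
      ≡⟨ sym (qFalling-suc m k) ⟩
    qFalling (suc m) (suc k) ∎
    where
    regroup : ∀ a b c d e → (a + b * c) * (d * e) ≡ a * e * d + b * (c * (d * e))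
    regroup = solve-∀
    factorOut : ∀ f a b c → f * a + b * (f * c) ≡ f * (a + b * c)
    factorOut = solve-∀
    qInt-split : qFalling m k * (qInt (suc k) + Q ^ suc k * qInt (m ∸ k)) ≡ qInt (suc m) * qFalling m k
    qInt-split with k ≤? m
    ... | yes k≤m = trans (cong (qFalling m k *_) (sym (trans (cong (qInt ∘ suc) (sym (m+[n∸m]≡n k≤m)))
                                                              (qInt-+ (suc k) (m ∸ k)))))
                          (*-comm (qFalling m k) _)
    ... | no k≰m rewrite qFalling-vanishes m k (≰⇒> k≰m) = sym (*-zeroʳ (qInt (suc m)))

  module _ (1≤Q : 1 ≤ Q) where

    ^-qInt : ∀ j → Q ^ j ≡ 1 + (Q ∸ 1) * qInt j
    ^-qInt zero    = sym (cong suc (*-zeroʳ (Q ∸ 1)))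
    ^-qInt (suc j) = begin
      Q * Q ^ j                              ≡⟨ cong₂ _*_ (sym (m+[n∸m]≡n 1≤Q)) (^-qInt j) ⟩
      (1 + (Q ∸ 1)) * (1 + (Q ∸ 1) * qInt j) ≡⟨ expand (Q ∸ 1) (qInt j) ⟩
      1 + (Q ∸ 1) * (1 + (1 + (Q ∸ 1)) * qInt j) ≡⟨ cong (λ z → 1 + (Q ∸ 1) * (1 + z * qInt j)) (m+[n∸m]≡n 1≤Q) ⟩
      1 + (Q ∸ 1) * qInt (suc j) ∎
      where
      expand : ∀ p x → (1 + p) * (1 + p * x) ≡ 1 + p * (1 + (1 + p) * x)
      expand = solve-∀

    ^∸^ : ∀ m i → Q ^ m ∸ Q ^ i ≡ Q ^ i * ((Q ∸ 1) * qInt (m ∸ i))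
    ^∸^ m i with i ≤? m
    ... | yes i≤m = begin
      Q ^ m ∸ Q ^ i                                 ≡⟨ cong (λ z → Q ^ z ∸ Q ^ i) (sym (m+[n∸m]≡n i≤m)) ⟩
      Q ^ (i + (m ∸ i)) ∸ Q ^ i                     ≡⟨ cong (_∸ Q ^ i) (^-distribˡ-+-* Q i (m ∸ i)) ⟩
      Q ^ i * Q ^ (m ∸ i) ∸ Q ^ i                   ≡⟨ cong (λ z → Q ^ i * z ∸ Q ^ i) (^-qInt (m ∸ i)) ⟩
      Q ^ i * (1 + (Q ∸ 1) * qInt (m ∸ i)) ∸ Q ^ i  ≡⟨ cong (_∸ Q ^ i) (expand (Q ^ i) _) ⟩
      Q ^ i + Q ^ i * ((Q ∸ 1) * qInt (m ∸ i)) ∸ Q ^ i ≡⟨ m+n∸m≡n (Q ^ i) _ ⟩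
      Q ^ i * ((Q ∸ 1) * qInt (m ∸ i)) ∎
      where
      expand : ∀ a b → a * (1 + b) ≡ a + a * b
      expand = solve-∀
    ... | no i≰m rewrite m≤n⇒m∸n≡0 (<⇒≤ (≰⇒> i≰m)) =
      trans (m≤n⇒m∸n≡0 (^-monoʳ-≤ Q {{ℕ.>-nonZero 1≤Q}} (<⇒≤ (≰⇒> i≰m))))
            (sym (trans (cong (Q ^ i *_) (*-zeroʳ (Q ∸ 1))) (*-zeroʳ (Q ^ i))))

    extensions≡qScale*qFalling : ∀ m k → extensions m 0 k ≡ qScale k * qFalling m k
    extensions≡qScale*qFalling m zero    = refl
    extensions≡qScale*qFalling m (suc k)
      rewrite extensions≡qScale*qFalling m k | +-identityʳ k | ^∸^ m k = regroup (qScale k) (qFalling m k) (Q ^ k) (Q ∸ 1) (qInt (m ∸ k))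
      where
      regroup : ∀ c f a p x → c * f * (a * (p * x)) ≡ c * (a * p) * (f * x)
      regroup = solve-∀

    extensions≡gauss*bases : ∀ m k → extensions m 0 k ≡ gauss m k * bases k
    extensions≡gauss*bases m k
      rewrite extensions≡qScale*qFalling m k | extensions≡qScale*qFalling k k | sym (gauss*qFalling m k) =
      swap (qScale k) (gauss m k) (qFalling k k)
      where
      swap : ∀ c g f → c * (g * f) ≡ g * (c * f)
      swap = solve-∀

    extensions-shift : ∀ m s k → extensions (m + s) s k ≡ extensions m 0 k * (Q ^ s) ^ k
    extensions-shift m s zero    = refl
    extensions-shift m s (suc k) rewrite extensions-shift m s k | +-identityʳ k = begin
      extensions m 0 k * (Q ^ s) ^ k * (Q ^ (m + s) ∸ Q ^ (k + s))
        ≡⟨ cong (extensions m 0 k * (Q ^ s) ^ k *_) factor-Q^s ⟩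
      extensions m 0 k * (Q ^ s) ^ k * ((Q ^ m ∸ Q ^ k) * Q ^ s)
        ≡⟨ regroup (extensions m 0 k) ((Q ^ s) ^ k) (Q ^ m ∸ Q ^ k) (Q ^ s) ⟩
      extensions m 0 k * (Q ^ m ∸ Q ^ k) * (Q ^ s * (Q ^ s) ^ k) ∎
      where
      factor-Q^s : Q ^ (m + s) ∸ Q ^ (k + s) ≡ (Q ^ m ∸ Q ^ k) * Q ^ s
      factor-Q^s = trans (cong₂ _∸_ (^-distribˡ-+-* Q m s) (^-distribˡ-+-* Q k s))
                         (sym (*-distribʳ-∸ (Q ^ s) (Q ^ m) (Q ^ k)))
      regroup : ∀ l p d x → l * p * (d * x) ≡ l * d * (x * p)
      regroup = solve-∀

    gauss*extensions : ∀ n a s → s ≤ a → a ≤ n →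
      gauss (n ∸ s) (a ∸ s) * extensions a s (a ∸ s) ≡ extensions n s (a ∸ s)
    gauss*extensions n a s s≤a a≤n = begin
      gauss (n ∸ s) k * extensions a s k             ≡⟨ cong (λ z → gauss (n ∸ s) k * extensions z s k) (sym (m∸n+n≡m s≤a)) ⟩
      gauss (n ∸ s) k * extensions (k + s) s k       ≡⟨ cong (gauss (n ∸ s) k *_) (extensions-shift k s k) ⟩
      gauss (n ∸ s) k * (bases k * (Q ^ s) ^ k)      ≡⟨ sym (*-assoc (gauss (n ∸ s) k) _ _) ⟩
      gauss (n ∸ s) k * bases k * (Q ^ s) ^ k        ≡⟨ cong (_* (Q ^ s) ^ k) (sym (extensions≡gauss*bases (n ∸ s) k)) ⟩
      extensions (n ∸ s) 0 k * (Q ^ s) ^ k           ≡⟨ sym (extensions-shift (n ∸ s) s k) ⟩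
      extensions (n ∸ s + s) s k                     ≡⟨ cong (λ z → extensions z s k) (m∸n+n≡m (≤-trans s≤a a≤n)) ⟩
      extensions n s k ∎
      where
      k = a ∸ s

  module _ (1<Q : 1 < Q) where

    extensions-pos : ∀ r s k → k + s ≤ r → 0 < extensions r s k
    extensions-pos r s zero    _   = s≤s z≤n
    extensions-pos r s (suc k) k+s<r =
      *-mono-< {0} {_} {0} (extensions-pos r s k (<⇒≤ k+s<r)) (m<n⇒0<n∸m (^-monoʳ-< Q 1<Q k+s<r))

    bases-pos : ∀ a → 0 < bases a
    bases-pos a = extensions-pos a 0 a (≤-reflexive (+-identityʳ a))

    ^-cancelˡ-≤ : ∀ a b → Q ^ a ≤ Q ^ b → a ≤ b
    ^-cancelˡ-≤ a b Qᵃ≤Qᵇ with ≤-<-connex a b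
    ... | inj₁ a≤b = a≤b
    ... | inj₂ b<a = ⊥-elim (<⇒≱ (^-monoʳ-< Q 1<Q b<a) Qᵃ≤Qᵇ)

    ^-injectiveʳ : ∀ a b → Q ^ a ≡ Q ^ b → a ≡ b
    ^-injectiveʳ a b e = ≤-antisym (^-cancelˡ-≤ a b (≤-reflexive e)) (^-cancelˡ-≤ b a (≤-reflexive (sym e)))

module IntegerSums where
  open import Data.Integer as ℤ using (ℤ; +_; _+_; _*_; -_)
  import Data.Integer.Properties as ℤP
  open import Data.Integer.Tactic.RingSolver using (solve-∀)
  open ListSums using (sumL)

  sumLℤ : {A : Set} → (A → ℤ) → List A → ℤ
  sumLℤ f []       = + 0
  sumLℤ f (x ∷ xs) = f x + sumLℤ f xs

  module _ {A : Set} where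

    sumLℤ-cong : {f g : A → ℤ} (L : List A) → (∀ x → f x ≡ g x) → sumLℤ f L ≡ sumLℤ g L
    sumLℤ-cong []      e = refl
    sumLℤ-cong (x ∷ L) e = cong₂ _+_ (e x) (sumLℤ-cong L e)

    sumLℤ-cong∈ : {f g : A → ℤ} (L : List A) → (∀ x → x ∈ L → f x ≡ g x) → sumLℤ f L ≡ sumLℤ g L
    sumLℤ-cong∈ []      e = refl
    sumLℤ-cong∈ (x ∷ L) e = cong₂ _+_ (e x (here refl)) (sumLℤ-cong∈ L (λ y y∈L → e y (there y∈L)))

    sumLℤ-+ : (f g : A → ℤ) (L : List A) → sumLℤ (λ x → f x + g x) L ≡ sumLℤ f L + sumLℤ g L
    sumLℤ-+ f g []      = refl
    sumLℤ-+ f g (x ∷ L) rewrite sumLℤ-+ f g L = interchange (f x) (g x) (sumLℤ f L) (sumLℤ g L)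
      where
      interchange : ∀ a b c d → (a + b) + (c + d) ≡ (a + c) + (b + d)
      interchange = solve-∀

    sumLℤ-*ˡ : (c : ℤ) (f : A → ℤ) (L : List A) → sumLℤ (λ x → c * f x) L ≡ c * sumLℤ f L
    sumLℤ-*ˡ c f []      = sym (ℤP.*-zeroʳ c)
    sumLℤ-*ˡ c f (x ∷ L) rewrite sumLℤ-*ˡ c f L = sym (ℤP.*-distribˡ-+ c (f x) _)

    sumLℤ-*ʳ : (f : A → ℤ) (c : ℤ) (L : List A) → sumLℤ (λ x → f x * c) L ≡ sumLℤ f L * c
    sumLℤ-*ʳ f c []      = sym (ℤP.*-zeroˡ c)
    sumLℤ-*ʳ f c (x ∷ L) rewrite sumLℤ-*ʳ f c L = sym (ℤP.*-distribʳ-+ c (f x) _)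

    sumLℤ-neg : (f : A → ℤ) (L : List A) → sumLℤ (λ x → - f x) L ≡ - sumLℤ f L
    sumLℤ-neg f []      = refl
    sumLℤ-neg f (x ∷ L) rewrite sumLℤ-neg f L = sym (ℤP.neg-distrib-+ (f x) _)

    sumLℤ-zero : (L : List A) → sumLℤ (λ _ → + 0) L ≡ + 0
    sumLℤ-zero []      = refl
    sumLℤ-zero (x ∷ L) = trans (ℤP.+-identityˡ _) (sumLℤ-zero L)

    +-sumL : (f : A → ℕ) (L : List A) → + sumL f L ≡ sumLℤ (λ x → + f x) L
    +-sumL f []      = refl
    +-sumL f (x ∷ L) = trans (ℤP.pos-+ (f x) _) (cong (_+_ (+ f x)) (+-sumL f L))

  sumLℤ-map : {A B : Set} (f : B → ℤ) (g : A → B) (L : List A) → sumLℤ f (List.map g L) ≡ sumLℤ (f ∘ g) L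
  sumLℤ-map f g []      = refl
  sumLℤ-map f g (x ∷ L) = cong (_+_ (f (g x))) (sumLℤ-map f g L)

  sumLℤ-swap : {A B : Set} (f : A → B → ℤ) (L : List A) (M : List B) →
    sumLℤ (λ x → sumLℤ (f x) M) L ≡ sumLℤ (λ y → sumLℤ (λ x → f x y) L) M
  sumLℤ-swap f []      M = sym (sumLℤ-zero M)
  sumLℤ-swap f (x ∷ L) M rewrite sumLℤ-swap f L M = sym (sumLℤ-+ (f x) _ M)

  sumLℤ-upTo-suc : ∀ (f : ℕ → ℤ) B → sumLℤ f (List.upTo (suc B)) ≡ f 0 + sumLℤ (f ∘ suc) (List.upTo B)
  sumLℤ-upTo-suc f B = trans (cong (sumLℤ f) (upTo-suc B)) (cong (_+_ (f 0)) (sumLℤ-map f suc (List.upTo B)))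

  sumLℤ-upTo-point : ∀ B k (g : ℕ → ℤ) → k < B →
    sumLℤ (λ j → if does (k ℕ.≟ j) then g j else + 0) (List.upTo B) ≡ g k
  sumLℤ-upTo-point (suc B) zero g _ = begin
    sumLℤ (λ j → if does (0 ℕ.≟ j) then g j else + 0) (List.upTo (suc B)) ≡⟨ sumLℤ-upTo-suc (λ j → if does (0 ℕ.≟ j) then g j else + 0) B ⟩
    g 0 + sumLℤ (λ _ → + 0) (List.upTo B)                              ≡⟨ cong (_+_ (g 0)) (sumLℤ-zero (List.upTo B)) ⟩
    g 0 + + 0                                                          ≡⟨ ℤP.+-identityʳ (g 0) ⟩
    g 0 ∎
    where open ≡-Reasoning
  sumLℤ-upTo-point (suc B) (suc k) g (s≤s k<B) = begin
    sumLℤ (λ j → if does (suc k ℕ.≟ j) then g j else + 0) (List.upTo (suc B))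
      ≡⟨ trans (sumLℤ-upTo-suc (λ j → if does (suc k ℕ.≟ j) then g j else + 0) B) (ℤP.+-identityˡ _) ⟩
    sumLℤ (λ j → if does (suc k ℕ.≟ suc j) then g (suc j) else + 0) (List.upTo B)
      ≡⟨ sumLℤ-cong (List.upTo B) (λ j → cong (λ z → if z then g (suc j) else + 0) (does-suc-≟ k j)) ⟩
    sumLℤ (λ j → if does (k ℕ.≟ j) then g (suc j) else + 0) (List.upTo B)
      ≡⟨ sumLℤ-upTo-point B k (g ∘ suc) k<B ⟩
    g (suc k) ∎
    where open ≡-Reasoning

  sumℤ≡sumLℤ-upTo : ∀ m (g : ℕ → ℤ) → sumℤ {m} (g ∘ toℕ) ≡ sumLℤ g (List.upTo m)
  sumℤ≡sumLℤ-upTo zero    g = refl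
  sumℤ≡sumLℤ-upTo (suc m) g = trans (cong (_+_ (g 0)) (sumℤ≡sumLℤ-upTo m (g ∘ suc)))
                                    (sym (sumLℤ-upTo-suc g m))

  sumℤ-cong : ∀ m (f g : Fin m → ℤ) → (∀ i → f i ≡ g i) → sumℤ f ≡ sumℤ g
  sumℤ-cong zero    f g f≗g = refl
  sumℤ-cong (suc m) f g f≗g = cong₂ _+_ (f≗g zero) (sumℤ-cong m (f ∘ suc) (g ∘ suc) (f≗g ∘ suc))

module IntegerPolynomials where
  open import Data.Integer as ℤ using (ℤ; +_; _+_; _*_; -_)
  import Data.Integer.Properties as ℤP
  open import Data.Integer.Tactic.RingSolver using (solve-∀)
  open IntegerSums using (sumLℤ)

  infixl 6 _+ₚ_
  infixl 7 _*ₚ_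

  _+ₚ_ : Poly → Poly → Poly
  []      +ₚ r       = r
  (a ∷ p) +ₚ []      = a ∷ p
  (a ∷ p) +ₚ (b ∷ r) = (a + b) ∷ (p +ₚ r)

  scaleₚ : ℤ → Poly → Poly
  scaleₚ c = List.map (c *_)

  _*ₚ_ : Poly → Poly → Poly
  []      *ₚ r = []
  (a ∷ p) *ₚ r = scaleₚ a r +ₚ (+ 0 ∷ p *ₚ r)

  -ₚ_ : Poly → Poly
  -ₚ_ = scaleₚ (- + 1)

  constₚ : ℤ → Poly
  constₚ c = c ∷ []

  X^ : ℕ → Poly
  X^ zero    = constₚ (+ 1)
  X^ (suc k) = + 0 ∷ X^ k

  gaussₚ : ℕ → ℕ → Poly
  gaussₚ m       zero    = constₚ (+ 1)
  gaussₚ zero    (suc k) = []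
  gaussₚ (suc m) (suc k) = gaussₚ m k +ₚ X^ (suc k) *ₚ gaussₚ m (suc k)

  sumₚ : {A : Set} → (A → Poly) → List A → Poly
  sumₚ f []       = []
  sumₚ f (x ∷ xs) = f x +ₚ sumₚ f xs

  module Evaluation (Q : ℕ) where
    open QArithmetic Q using (gauss)

    eval : Poly → ℤ
    eval p = evalPoly p (+ Q)

    eval-+ₚ : ∀ p r → eval (p +ₚ r) ≡ eval p + eval r
    eval-+ₚ []      r       = sym (ℤP.+-identityˡ (eval r))
    eval-+ₚ (a ∷ p) []      = sym (ℤP.+-identityʳ _)
    eval-+ₚ (a ∷ p) (b ∷ r) rewrite eval-+ₚ p r = regroup a b (+ Q) (eval p) (eval r)
      where
      regroup : ∀ a b t x y → (a + b) + t * (x + y) ≡ (a + t * x) + (b + t * y)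
      regroup = solve-∀

    eval-scaleₚ : ∀ c p → eval (scaleₚ c p) ≡ c * eval p
    eval-scaleₚ c []      = sym (ℤP.*-zeroʳ c)
    eval-scaleₚ c (a ∷ p) rewrite eval-scaleₚ c p = regroup c a (+ Q) (eval p)
      where
      regroup : ∀ c a t x → c * a + t * (c * x) ≡ c * (a + t * x)
      regroup = solve-∀

    eval-*ₚ : ∀ p r → eval (p *ₚ r) ≡ eval p * eval r
    eval-*ₚ []      r = refl
    eval-*ₚ (a ∷ p) r rewrite eval-+ₚ (scaleₚ a r) (+ 0 ∷ p *ₚ r) | eval-scaleₚ a r | eval-*ₚ p r =
      regroup a (+ Q) (eval p) (eval r)
      where
      regroup : ∀ a t x y → a * y + (+ 0 + t * (x * y)) ≡ (a + t * x) * y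
      regroup = solve-∀

    eval--ₚ : ∀ p → eval (-ₚ p) ≡ - eval p
    eval--ₚ p = trans (eval-scaleₚ (- + 1) p) (ℤP.-1*i≡-i (eval p))

    eval-constₚ : ∀ c → eval (constₚ c) ≡ c
    eval-constₚ c = trans (cong (_+_ c) (ℤP.*-zeroʳ (+ Q))) (ℤP.+-identityʳ c)

    eval-X^ : ∀ k → eval (X^ k) ≡ + (Q ^ k)
    eval-X^ zero    = eval-constₚ (+ 1)
    eval-X^ (suc k) rewrite eval-X^ k = trans (ℤP.+-identityˡ _) (sym (ℤP.pos-* Q (Q ^ k)))

    eval-gaussₚ : ∀ m k → eval (gaussₚ m k) ≡ + gauss m k
    eval-gaussₚ m       zero    = eval-constₚ (+ 1)
    eval-gaussₚ zero    (suc k) = refl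
    eval-gaussₚ (suc m) (suc k)
      rewrite eval-+ₚ (gaussₚ m k) (X^ (suc k) *ₚ gaussₚ m (suc k)) | eval-*ₚ (X^ (suc k)) (gaussₚ m (suc k))
            | eval-gaussₚ m k | eval-gaussₚ m (suc k) | eval-X^ (suc k) =
      trans (cong (_+_ (+ gauss m k)) (sym (ℤP.pos-* (Q ^ suc k) _))) (sym (ℤP.pos-+ (gauss m k) _))

    eval-sumₚ : {A : Set} (f : A → Poly) (L : List A) → eval (sumₚ f L) ≡ sumLℤ (eval ∘ f) L
    eval-sumₚ f []      = refl
    eval-sumₚ f (x ∷ L) rewrite eval-+ₚ (f x) (sumₚ f L) | eval-sumₚ f L = refl

module FieldVectors (F : FiniteField) where
  open import Algebra.Structures using (IsCommutativeRing)
  open import Data.Vec using (tabulate; replicate)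
  open ListSums
  open FiniteField F public
  open LinAlg F public
  open IsCommutativeRing isCommutativeRing public
    using (+-assoc; +-comm; +-identityˡ; +-identityʳ; *-assoc; *-comm; *-identityˡ;
           distribˡ; distribʳ; zeroˡ; zeroʳ; -‿inverseˡ; -‿inverseʳ)

  q : ℕ
  q = size

  private module E = Inverse enum

  from-injective : ∀ x y → E.from x ≡ E.from y → x ≡ y
  from-injective x y e = trans (sym (E.strictlyInverseˡ x))
                               (trans (cong (E.to) e) (E.strictlyInverseˡ y))

  _≟F_ : DecidableEquality Carrier
  x ≟F y = map′ (from-injective x y) (cong (E.from))
                                           (E.from x FinP.≟ E.from y)

  1<q : 1 < q
  1<q = two-distinct (E.from 0#) (E.from 1#) (0≢1 ∘ from-injective 0# 1#)
    where
    two-distinct : ∀ {m} (i j : Fin m) → i ≢ j → 1 < m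
    two-distinct {suc zero}    zero zero i≢j = ⊥-elim (i≢j refl)
    two-distinct {suc (suc m)} _    _    _   = s≤s (s≤s z≤n)

  1≤q : 1 ≤ q
  1≤q = ℕP.<⇒≤ 1<q

  elements : List Carrier
  elements = List.map (E.to) (List.allFin size)

  allFin-suc : ∀ m → List.allFin (suc m) ≡ zero ∷ List.map suc (List.allFin m)
  allFin-suc m = cong (zero ∷_) (sym (ListP.map-tabulate (λ i → i) suc))

  allFin-enumerates : ∀ m → Enumerates FinP._≟_ (List.allFin m)
  allFin-enumerates (suc m) i = begin
    count (λ j → does (j FinP.≟ i)) (List.allFin (suc m))
      ≡⟨ cong (count (λ j → does (j FinP.≟ i))) (allFin-suc m) ⟩
    count (λ j → does (j FinP.≟ i)) (zero ∷ List.map suc (List.allFin m))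
      ≡⟨ cong (𝟙 (does (zero FinP.≟ i)) ℕ.+_) (sumL-map (λ j → 𝟙 (does (j FinP.≟ i))) suc (List.allFin m)) ⟩
    𝟙 (does (zero FinP.≟ i)) ℕ.+ count (λ j → does (suc j FinP.≟ i)) (List.allFin m)
      ≡⟨ at i ⟩
    1 ∎
    where
    open ≡-Reasoning
    at : ∀ i → 𝟙 (does (zero FinP.≟ i)) ℕ.+ count (λ j → does (suc j FinP.≟ i)) (List.allFin m) ≡ 1
    at zero    = cong suc (count-none _ (List.allFin m) (λ _ → refl))
    at (suc i) = trans (count-cong (List.allFin m) (λ j → does-⇔ (mk⇔ FinP.suc-injective (cong suc)) (suc j FinP.≟ suc i) (j FinP.≟ i)))
                       (allFin-enumerates m i)

  elements-enumerates : Enumerates _≟F_ elements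
  elements-enumerates x = trans (sumL-map _ _ (List.allFin size))
    (trans (count-cong (List.allFin size) same) (allFin-enumerates size (E.from x)))
    where
    same : ∀ j → does (E.to j ≟F x) ≡ does (j FinP.≟ E.from x)
    same j = does-⇔ (mk⇔ (λ e → trans (sym (E.strictlyInverseʳ j)) (cong (E.from) e))
                         (λ e → trans (cong (E.to) e) (E.strictlyInverseˡ x)))
                    (E.to j ≟F x) (j FinP.≟ E.from x)

  count-elements : count (λ _ → true) elements ≡ q
  count-elements = trans (count-true≡length elements)
                         (trans (ListP.length-map _ (List.allFin size)) (ListP.length-tabulate {n = size} (λ i → i)))

  _≟V_ : ∀ {n} → DecidableEquality (Vector n)
  _≟V_ = VecP.≡-dec _≟F_

  vectors : ∀ n → List (Vector n)
  vectors = vecsOver elements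

  vectors-enumerates : ∀ n → Enumerates _≟V_ (vectors n)
  vectors-enumerates = vecsOver-enumerates _≟F_ elements-enumerates

  ∈-vectors : ∀ {n} (v : Vector n) → v ∈ vectors n
  ∈-vectors {n} = enumerates⇒∈ _≟V_ (vectors-enumerates n)

  count-vectors : ∀ n → count (λ _ → true) (vectors n) ≡ q ^ n
  count-vectors n = trans (count-vecsOver elements n) (cong (_^ n) count-elements)

  lookup-ext : ∀ {A : Set} {n} (xs ys : Vec A n) → (∀ i → lookup xs i ≡ lookup ys i) → xs ≡ ys
  lookup-ext []       []       h = refl
  lookup-ext (x ∷ xs) (y ∷ ys) h = cong₂ _∷_ (h zero) (lookup-ext xs ys (h ∘ suc))

  zeroV-++ : ∀ m e → zeroV {m ℕ.+ e} ≡ zeroV {m} ++ zeroV {e}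
  zeroV-++ zero    e = refl
  zeroV-++ (suc m) e = cong (0# ∷_) (zeroV-++ m e)

  -1*x≡-x : ∀ x → (- 1#) * x ≡ - x
  -1*x≡-x x = begin
    (- 1#) * x                 ≡⟨ sym (+-identityʳ _) ⟩
    (- 1#) * x + 0#            ≡⟨ cong ((- 1#) * x +_) (sym (-‿inverseʳ x)) ⟩
    (- 1#) * x + (x + - x)     ≡⟨ sym (+-assoc _ x _) ⟩
    ((- 1#) * x + x) + - x     ≡⟨ cong (λ y → ((- 1#) * x + y) + - x) (sym (*-identityˡ x)) ⟩
    ((- 1#) * x + 1# * x) + - x ≡⟨ cong (_+ - x) (sym (distribʳ x (- 1#) 1#)) ⟩
    ((- 1# + 1#) * x) + - x    ≡⟨ cong (λ y → y * x + - x) (-‿inverseˡ 1#) ⟩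
    0# * x + - x               ≡⟨ cong (_+ - x) (zeroˡ x) ⟩
    0# + - x                   ≡⟨ +-identityˡ _ ⟩
    - x ∎
    where open ≡-Reasoning

  -1≢0 : - 1# ≢ 0#
  -1≢0 -1≡0 = 0≢1 (begin
    0#        ≡⟨ sym (-‿inverseʳ 1#) ⟩
    1# + - 1# ≡⟨ cong (1# +_) -1≡0 ⟩
    1# + 0#   ≡⟨ +-identityʳ 1# ⟩
    1# ∎)
    where open ≡-Reasoning

  -ᵥ_ : ∀ {n} → Vector n → Vector n
  -ᵥ v = (- 1#) ·ᵥ v

  +ᵥ-assoc : ∀ {n} (u v w : Vector n) → (u +ᵥ v) +ᵥ w ≡ u +ᵥ (v +ᵥ w)
  +ᵥ-assoc = VecP.zipWith-assoc +-assoc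

  +ᵥ-comm : ∀ {n} (u v : Vector n) → u +ᵥ v ≡ v +ᵥ u
  +ᵥ-comm = VecP.zipWith-comm +-comm

  +ᵥ-identityˡ : ∀ {n} (v : Vector n) → zeroV +ᵥ v ≡ v
  +ᵥ-identityˡ = VecP.zipWith-identityˡ +-identityˡ

  +ᵥ-identityʳ : ∀ {n} (v : Vector n) → v +ᵥ zeroV ≡ v
  +ᵥ-identityʳ = VecP.zipWith-identityʳ +-identityʳ

  -ᵥ-inverseʳ : ∀ {n} (v : Vector n) → v +ᵥ (-ᵥ v) ≡ zeroV
  -ᵥ-inverseʳ = VecP.zipWith-inverseʳ (λ x → trans (cong (x +_) (-1*x≡-x x)) (-‿inverseʳ x))

  +ᵥ-interchange : ∀ {n} (a b c d : Vector n) → (a +ᵥ b) +ᵥ (c +ᵥ d) ≡ (a +ᵥ c) +ᵥ (b +ᵥ d)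
  +ᵥ-interchange a b c d = begin
    (a +ᵥ b) +ᵥ (c +ᵥ d) ≡⟨ +ᵥ-assoc a b _ ⟩
    a +ᵥ (b +ᵥ (c +ᵥ d)) ≡⟨ cong (a +ᵥ_) (sym (+ᵥ-assoc b c d)) ⟩
    a +ᵥ ((b +ᵥ c) +ᵥ d) ≡⟨ cong (λ z → a +ᵥ (z +ᵥ d)) (+ᵥ-comm b c) ⟩
    a +ᵥ ((c +ᵥ b) +ᵥ d) ≡⟨ cong (a +ᵥ_) (+ᵥ-assoc c b d) ⟩
    a +ᵥ (c +ᵥ (b +ᵥ d)) ≡⟨ sym (+ᵥ-assoc a c _) ⟩
    (a +ᵥ c) +ᵥ (b +ᵥ d) ∎
    where open ≡-Reasoning

  +ᵥ≡0⇒≡-ᵥ : ∀ {n} (u v : Vector n) → u +ᵥ v ≡ zeroV → u ≡ -ᵥ v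
  +ᵥ≡0⇒≡-ᵥ u v u+v≡0 = begin
    u                    ≡⟨ sym (+ᵥ-identityʳ u) ⟩
    u +ᵥ zeroV           ≡⟨ cong (u +ᵥ_) (sym (-ᵥ-inverseʳ v)) ⟩
    u +ᵥ (v +ᵥ (-ᵥ v))   ≡⟨ sym (+ᵥ-assoc u v _) ⟩
    (u +ᵥ v) +ᵥ (-ᵥ v)   ≡⟨ cong (_+ᵥ (-ᵥ v)) u+v≡0 ⟩
    zeroV +ᵥ (-ᵥ v)      ≡⟨ +ᵥ-identityˡ _ ⟩
    -ᵥ v ∎
    where open ≡-Reasoning

  ·ᵥ-distribˡ : ∀ {n} a (u v : Vector n) → a ·ᵥ (u +ᵥ v) ≡ (a ·ᵥ u) +ᵥ (a ·ᵥ v)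
  ·ᵥ-distribˡ a []      []      = refl
  ·ᵥ-distribˡ a (x ∷ u) (y ∷ v) = cong₂ _∷_ (distribˡ a x y) (·ᵥ-distribˡ a u v)

  ·ᵥ-distribʳ : ∀ {n} a b (v : Vector n) → (a + b) ·ᵥ v ≡ (a ·ᵥ v) +ᵥ (b ·ᵥ v)
  ·ᵥ-distribʳ a b []      = refl
  ·ᵥ-distribʳ a b (x ∷ v) = cong₂ _∷_ (distribʳ x a b) (·ᵥ-distribʳ a b v)

  ·ᵥ-assoc : ∀ {n} a b (v : Vector n) → a ·ᵥ (b ·ᵥ v) ≡ (a * b) ·ᵥ v
  ·ᵥ-assoc a b v = trans (sym (VecP.map-∘ (a *_) (b *_) v)) (VecP.map-cong (λ x → sym (*-assoc a b x)) v)

  ·ᵥ-identity : ∀ {n} (v : Vector n) → 1# ·ᵥ v ≡ v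
  ·ᵥ-identity v = trans (VecP.map-cong *-identityˡ v) (VecP.map-id v)

  ·ᵥ-zeroˡ : ∀ {n} (v : Vector n) → 0# ·ᵥ v ≡ zeroV
  ·ᵥ-zeroˡ v = trans (VecP.map-cong zeroˡ v) (VecP.map-const v 0#)

  ·ᵥ-zeroʳ : ∀ {n} a → a ·ᵥ zeroV {n} ≡ zeroV
  ·ᵥ-zeroʳ {n} a = trans (VecP.map-replicate (a *_) 0# n) (cong (replicate n) (zeroʳ a))

  ring : CommutativeRing 0ℓ 0ℓ
  ring = record { isCommutativeRing = isCommutativeRing }

  +-interchange : ∀ a b c d → (a + b) + (c + d) ≡ (a + c) + (b + d)
  +-interchange = interchange
    where open import Algebra.Properties.CommutativeSemigroup (CommutativeRing.+-commutativeSemigroup ring)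

  x+-y≡0⇒x≡y : ∀ {n} (u v : Vector n) → u +ᵥ (-ᵥ v) ≡ zeroV → u ≡ v
  x+-y≡0⇒x≡y u v u-v≡0 = begin
    u                       ≡⟨ sym (+ᵥ-identityʳ u) ⟩
    u +ᵥ zeroV              ≡⟨ cong (u +ᵥ_) (sym (trans (+ᵥ-comm _ v) (-ᵥ-inverseʳ v))) ⟩
    u +ᵥ ((-ᵥ v) +ᵥ v)      ≡⟨ sym (+ᵥ-assoc u _ v) ⟩
    (u +ᵥ (-ᵥ v)) +ᵥ v      ≡⟨ cong (_+ᵥ v) u-v≡0 ⟩
    zeroV +ᵥ v              ≡⟨ +ᵥ-identityˡ v ⟩
    v ∎
    where open ≡-Reasoning

  lincomb-+ : ∀ {n d} (c e : Vector d) (vs : Vec (Vector n) d) → lincomb (c +ᵥ e) vs ≡ lincomb c vs +ᵥ lincomb e vs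
  lincomb-+ []      []      []       = sym (+ᵥ-identityˡ zeroV)
  lincomb-+ (a ∷ c) (b ∷ e) (v ∷ vs) rewrite lincomb-+ c e vs | ·ᵥ-distribʳ a b v =
    +ᵥ-interchange (a ·ᵥ v) (b ·ᵥ v) _ _

  lincomb-· : ∀ {n d} a (c : Vector d) (vs : Vec (Vector n) d) → lincomb (a ·ᵥ c) vs ≡ a ·ᵥ lincomb c vs
  lincomb-· a []      []       = sym (·ᵥ-zeroʳ a)
  lincomb-· a (b ∷ c) (v ∷ vs) rewrite lincomb-· a c vs | ·ᵥ-distribˡ a (b ·ᵥ v) (lincomb c vs) | ·ᵥ-assoc a b v = refl

  lincomb-zero : ∀ {n d} (vs : Vec (Vector n) d) → lincomb zeroV vs ≡ zeroV
  lincomb-zero []       = refl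
  lincomb-zero (v ∷ vs) rewrite lincomb-zero vs | ·ᵥ-zeroˡ v = +ᵥ-identityˡ zeroV

  lincomb-++ : ∀ {n d e} (c : Vector d) (c′ : Vector e) (xs : Vec (Vector n) d) ys →
    lincomb (c ++ c′) (xs ++ ys) ≡ lincomb c xs +ᵥ lincomb c′ ys
  lincomb-++ []      c′ []       ys = sym (+ᵥ-identityˡ _)
  lincomb-++ (a ∷ c) c′ (x ∷ xs) ys rewrite lincomb-++ c c′ xs ys = sym (+ᵥ-assoc _ _ _)

  lincomb-lookup : ∀ {n d} (vs : Vec (Vector n) d) i → ∃[ c ] (lincomb c vs ≡ lookup vs i)
  lincomb-lookup (v ∷ vs) zero    = (1# ∷ zeroV) , trans (cong₂ _+ᵥ_ (·ᵥ-identity v) (lincomb-zero vs)) (+ᵥ-identityʳ v)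
  lincomb-lookup (v ∷ vs) (suc i) with lincomb-lookup vs i
  ... | c , e = (0# ∷ c) , trans (cong₂ _+ᵥ_ (·ᵥ-zeroˡ v) e) (+ᵥ-identityˡ _)

  sumF-tabulate-+ : ∀ {m} (f g : Fin m → Carrier) →
    sumF (tabulate (λ j → f j + g j)) ≡ sumF (tabulate f) + sumF (tabulate g)
  sumF-tabulate-+ {zero}  f g = sym (+-identityˡ 0#)
  sumF-tabulate-+ {suc m} f g rewrite sumF-tabulate-+ (f ∘ suc) (g ∘ suc) = +-interchange (f zero) (g zero) _ _

  sumF-tabulate-* : ∀ {m} a (f : Fin m → Carrier) → sumF (tabulate (λ j → a * f j)) ≡ a * sumF (tabulate f)
  sumF-tabulate-* {zero}  a f = sym (zeroʳ a)
  sumF-tabulate-* {suc m} a f rewrite sumF-tabulate-* a (f ∘ suc) = sym (distribˡ a _ _)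

  apply-+ : ∀ {n} (T : Matrix n) (u v : Vector n) → apply T (u +ᵥ v) ≡ apply T u +ᵥ apply T v
  apply-+ T u v = lookup-ext _ _ λ i → begin
    lookup (apply T (u +ᵥ v)) i
      ≡⟨ VecP.lookup∘tabulate _ i ⟩
    sumF (tabulate λ j → T i j * lookup (u +ᵥ v) j)
      ≡⟨ cong sumF (VecP.tabulate-cong (λ j → trans (cong (T i j *_) (VecP.lookup-zipWith _+_ j u v)) (distribˡ (T i j) _ _))) ⟩
    sumF (tabulate λ j → T i j * lookup u j + T i j * lookup v j)
      ≡⟨ sumF-tabulate-+ (λ j → T i j * lookup u j) (λ j → T i j * lookup v j) ⟩
    sumF (tabulate λ j → T i j * lookup u j) + sumF (tabulate λ j → T i j * lookup v j)
      ≡⟨ sym (cong₂ _+_ (VecP.lookup∘tabulate _ i) (VecP.lookup∘tabulate _ i)) ⟩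
    lookup (apply T u) i + lookup (apply T v) i
      ≡⟨ sym (VecP.lookup-zipWith _+_ i (apply T u) _) ⟩
    lookup (apply T u +ᵥ apply T v) i ∎
    where open ≡-Reasoning

  apply-· : ∀ {n} (T : Matrix n) a (v : Vector n) → apply T (a ·ᵥ v) ≡ a ·ᵥ apply T v
  apply-· T a v = lookup-ext _ _ λ i → begin
    lookup (apply T (a ·ᵥ v)) i
      ≡⟨ VecP.lookup∘tabulate _ i ⟩
    sumF (tabulate λ j → T i j * lookup (a ·ᵥ v) j)
      ≡⟨ cong sumF (VecP.tabulate-cong (λ j → trans (cong (T i j *_) (VecP.lookup-map j (a *_) v)) (swap (T i j) a _))) ⟩
    sumF (tabulate λ j → a * (T i j * lookup v j))
      ≡⟨ sumF-tabulate-* a (λ j → T i j * lookup v j) ⟩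
    a * sumF (tabulate λ j → T i j * lookup v j)
      ≡⟨ cong (a *_) (sym (VecP.lookup∘tabulate _ i)) ⟩
    a * lookup (apply T v) i
      ≡⟨ sym (VecP.lookup-map i (a *_) (apply T v)) ⟩
    lookup (a ·ᵥ apply T v) i ∎
    where
    open ≡-Reasoning
    swap : ∀ t a x → t * (a * x) ≡ a * (t * x)
    swap t a x = trans (sym (*-assoc t a x)) (trans (cong (_* x) (*-comm t a)) (*-assoc a t x))

  apply-zero : ∀ {n} (T : Matrix n) → apply T zeroV ≡ zeroV
  apply-zero {n} T = begin
    apply T zeroV           ≡⟨ cong (apply T) (sym (·ᵥ-zeroˡ zeroV)) ⟩
    apply T (0# ·ᵥ zeroV)   ≡⟨ apply-· T 0# zeroV ⟩
    0# ·ᵥ apply T zeroV     ≡⟨ ·ᵥ-zeroˡ _ ⟩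
    zeroV ∎
    where open ≡-Reasoning

  apply-lincomb : ∀ {n d} (T : Matrix n) (c : Vector d) (vs : Vec (Vector n) d) →
    apply T (lincomb c vs) ≡ lincomb c (Vec.map (apply T) vs)
  apply-lincomb T []      []       = apply-zero T
  apply-lincomb T (a ∷ c) (v ∷ vs) =
    trans (apply-+ T (a ·ᵥ v) (lincomb c vs)) (cong₂ _+ᵥ_ (apply-· T a v) (apply-lincomb T c vs))

module Subspaces (F : FiniteField) where
  open import Data.List.Relation.Unary.All as All using (all?)
  open import Data.List.Relation.Unary.Any using (any?; satisfied)
  open import Data.List.Membership.Propositional using (lose)
  open ListSums
  open FieldVectors F
  open QArithmetic q using (^-cancelˡ-≤; ^-injectiveʳ)

  card : ∀ {n} → SubsetV n → ℕ
  card {n} W = count W (vectors n)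

  _≈?_ : ∀ {n} → SubsetV n → SubsetV n → Bool
  _≈?_ {n} W W′ = does (all? (λ v → W v Bool.≟ W′ v) (vectors n))

  ≈?-sound : ∀ {n} (W W′ : SubsetV n) → W ≈? W′ ≡ true → W ≈ˢ W′
  ≈?-sound {n} W W′ e v = All.lookup (does-true⁻ (all? (λ v → W v Bool.≟ W′ v) (vectors n)) e) (∈-vectors v)

  ≈?-complete : ∀ {n} (W W′ : SubsetV n) → W ≈ˢ W′ → W ≈? W′ ≡ true
  ≈?-complete {n} W W′ W≈W′ = dec-true (all? (λ v → W v Bool.≟ W′ v) (vectors n)) (All.tabulate (λ {v} _ → W≈W′ v))

  ≈?-sym : ∀ {n} (W W′ : SubsetV n) → W ≈? W′ ≡ W′ ≈? W
  ≈?-sym W W′ = bool-ext (λ e → ≈?-complete W′ W (sym ∘ ≈?-sound W W′ e)) (λ e → ≈?-complete W W′ (sym ∘ ≈?-sound W′ W e))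

  IsSubspace-≈ : ∀ {n} (W W′ : SubsetV n) → W ≈ˢ W′ → IsSubspace W → IsSubspace W′
  IsSubspace-≈ W W′ e (zero∈ , +∈ , ·∈) = trans (sym (e zeroV)) zero∈
    , (λ u v u∈ v∈ → trans (sym (e (u +ᵥ v))) (+∈ u v (trans (e u) u∈) (trans (e v) v∈)))
    , (λ c v v∈ → trans (sym (e (c ·ᵥ v))) (·∈ c v (trans (e v) v∈)))

  HasDim-≈ : ∀ {n} (W W′ : SubsetV n) d → W ≈ˢ W′ → HasDim W d → HasDim W′ d
  HasDim-≈ W W′ d e (vs , li , spans) =
    vs , li , λ v → mk⇔ (Equivalence.to (spans v) ∘ trans (e v)) (trans (sym (e v)) ∘ Equivalence.from (spans v))

  allIn : ∀ {n d} → SubsetV n → Vec (Vector n) d → Bool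
  allIn W []       = true
  allIn W (v ∷ vs) = W v ∧ allIn W vs

  allIn-lookup : ∀ {n d} (W : SubsetV n) (vs : Vec (Vector n) d) → allIn W vs ≡ true → ∀ i → W (lookup vs i) ≡ true
  allIn-lookup W (v ∷ vs) e zero    = proj₁ (∧-true⁻ e)
  allIn-lookup W (v ∷ vs) e (suc i) = allIn-lookup W vs (proj₂ (∧-true⁻ {W v} e)) i

  lookup-allIn : ∀ {n d} (W : SubsetV n) (vs : Vec (Vector n) d) → (∀ i → W (lookup vs i) ≡ true) → allIn W vs ≡ true
  lookup-allIn W []       h = refl
  lookup-allIn W (v ∷ vs) h = ∧-true⁺ (h zero) (lookup-allIn W vs (h ∘ suc))

  allIn-++ : ∀ {n d e} (W : SubsetV n) (xs : Vec (Vector n) d) (ys : Vec (Vector n) e) →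
    allIn W (xs ++ ys) ≡ allIn W xs ∧ allIn W ys
  allIn-++ W []       ys = refl
  allIn-++ W (x ∷ xs) ys rewrite allIn-++ W xs ys = sym (BoolP.∧-assoc (W x) _ _)

  allIn-full : ∀ {n d} (xs : Vec (Vector n) d) → allIn (λ _ → true) xs ≡ true
  allIn-full []       = refl
  allIn-full (v ∷ xs) = allIn-full xs

  allIn-map : ∀ {n k} (W : SubsetV n) (f : Vector n → Vector n) (xs : Vec (Vector n) k) →
    allIn W (Vec.map f xs) ≡ true ⇔ (∀ i → W (f (lookup xs i)) ≡ true)
  allIn-map W f xs = mk⇔
    (λ h i → trans (cong W (sym (VecP.lookup-map i f xs))) (allIn-lookup W (Vec.map f xs) h i))
    (λ h → lookup-allIn W (Vec.map f xs) (λ i → trans (cong W (VecP.lookup-map i f xs)) (h i)))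

  InSpan : ∀ {n d} → Vec (Vector n) d → Vector n → Set
  InSpan vs v = ∃[ c ] (lincomb c vs ≡ v)

  span : ∀ {n d} → Vec (Vector n) d → SubsetV n
  span {d = d} vs v = does (any? (λ c → lincomb c vs ≟V v) (vectors d))

  span-sound : ∀ {n d} (vs : Vec (Vector n) d) v → span vs v ≡ true → InSpan vs v
  span-sound {d = d} vs v e = satisfied (does-true⁻ (any? (λ c → lincomb c vs ≟V v) (vectors d)) e)

  span-complete : ∀ {n d} (vs : Vec (Vector n) d) v → InSpan vs v → span vs v ≡ true
  span-complete {d = d} vs v (c , e) = dec-true (any? (λ c → lincomb c vs ≟V v) (vectors d)) (lose (∈-vectors c) e)

  span-false : ∀ {n d} (vs : Vec (Vector n) d) v → span vs v ≡ false → ¬ InSpan vs v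
  span-false vs v e s = true≢false (span-complete vs v s) e

  span-lookup : ∀ {n d} (vs : Vec (Vector n) d) i → span vs (lookup vs i) ≡ true
  span-lookup vs i = span-complete vs _ (lincomb-lookup vs i)

  span-++ : ∀ {n d e} (xs : Vec (Vector n) d) (ys : Vec (Vector n) e) v →
    InSpan (xs ++ ys) v → ∃[ c ] ∃[ c′ ] (lincomb c xs +ᵥ lincomb c′ ys ≡ v)
  span-++ {d = d} xs ys v (c , e) with Vec.splitAt d c
  ... | c₁ , c₂ , refl = c₁ , c₂ , trans (sym (lincomb-++ c₁ c₂ xs ys)) e

  span-++[] : ∀ {n d} (xs : Vec (Vector n) d) v → span (xs ++ []) v ≡ span xs v
  span-++[] xs v = bool-ext to from
    where
    to : span (xs ++ []) v ≡ true → span xs v ≡ true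
    to h with span-++ xs [] v (span-sound _ v h)
    ... | c , [] , e = span-complete xs v (c , trans (sym (+ᵥ-identityʳ _)) e)
    from : span xs v ≡ true → span (xs ++ []) v ≡ true
    from h with span-sound xs v h
    ... | c , e = span-complete _ v ((c ++ []) , trans (lincomb-++ c [] xs []) (trans (+ᵥ-identityʳ _) e))

  lincomb-∈ : ∀ {n d} (W : SubsetV n) → IsSubspace W → (vs : Vec (Vector n) d) → allIn W vs ≡ true →
    ∀ c → W (lincomb c vs) ≡ true
  lincomb-∈ W (zero∈ , _  , _ ) []       _  []      = zero∈
  lincomb-∈ W S@(_ , +∈ , ·∈) (v ∷ vs) e (a ∷ c) =
    +∈ _ _ (·∈ a v (proj₁ (∧-true⁻ e))) (lincomb-∈ W S vs (proj₂ (∧-true⁻ {W v} e)) c)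

  span-⊆ : ∀ {n d} (W : SubsetV n) → IsSubspace W → (vs : Vec (Vector n) d) → allIn W vs ≡ true →
    ∀ v → span vs v ≡ true → W v ≡ true
  span-⊆ W S vs vs⊆W v v∈ with span-sound vs v v∈
  ... | c , refl = lincomb-∈ W S vs vs⊆W c

  span-isSubspace : ∀ {n d} (vs : Vec (Vector n) d) → IsSubspace (span vs)
  span-isSubspace vs = span-complete vs _ (zeroV , lincomb-zero vs) , +-closed , ·-closed
    where
    +-closed : ∀ u v → span vs u ≡ true → span vs v ≡ true → span vs (u +ᵥ v) ≡ true
    +-closed u v u∈ v∈ with span-sound vs u u∈ | span-sound vs v v∈
    ... | c , refl | c′ , refl = span-complete vs _ ((c +ᵥ c′) , lincomb-+ c c′ vs)
    ·-closed : ∀ a v → span vs v ≡ true → span vs (a ·ᵥ v) ≡ true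
    ·-closed a v v∈ with span-sound vs v v∈
    ... | c , refl = span-complete vs _ ((a ·ᵥ c) , lincomb-· a c vs)

  Independent : ∀ {n d} → Vec (Vector n) d → Set
  Independent {d = d} vs = ∀ (c : Vector d) → lincomb c vs ≡ zeroV → c ≡ zeroV

  LinIndep⇒Independent : ∀ {n d} (vs : Vec (Vector n) d) → LinIndep vs → Independent vs
  LinIndep⇒Independent vs h c e = lookup-ext c zeroV (λ i → trans (h c e i) (sym (VecP.lookup-replicate i 0#)))

  Independent⇒LinIndep : ∀ {n d} (vs : Vec (Vector n) d) → Independent vs → LinIndep vs
  Independent⇒LinIndep vs h c e i = trans (cong (λ z → lookup z i) (h c e)) (VecP.lookup-replicate i 0#)

  []-independent : ∀ {n} → Independent ([] {A = Vector n})
  []-independent [] _ = refl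

  Independent-∷⁻ : ∀ {n d} v (vs : Vec (Vector n) d) → Independent (v ∷ vs) → Independent vs × ¬ InSpan vs v
  Independent-∷⁻ v vs h = tail-independent , v∉span
    where
    tail-independent : Independent vs
    tail-independent c e = VecP.∷-injectiveʳ (h (0# ∷ c) (trans (cong₂ _+ᵥ_ (·ᵥ-zeroˡ v) e) (+ᵥ-identityˡ zeroV)))
    v∉span : ¬ InSpan vs v
    v∉span (c , e) = -1≢0 (VecP.∷-injectiveˡ (h ((- 1#) ∷ c)
      (trans (cong (((- 1#) ·ᵥ v) +ᵥ_) e) (trans (+ᵥ-comm _ v) (-ᵥ-inverseʳ v)))))

  -- A relation a v + Σ c vs = 0 with a ≠ 0 would put v = a⁻¹ (- Σ c vs) in the span of vs.
  Independent-∷⁺ : ∀ {n d} v (vs : Vec (Vector n) d) → Independent vs → ¬ InSpan vs v → Independent (v ∷ vs)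
  Independent-∷⁺ v vs indep v∉span (a ∷ c) e with a ≟F 0#
  ... | yes refl = cong (0# ∷_) (indep c (trans (sym (+ᵥ-identityˡ _)) (trans (cong (_+ᵥ lincomb c vs) (sym (·ᵥ-zeroˡ v))) e)))
  ... | no a≢0 with inverse a a≢0
  ... | b , ab≡1 = ⊥-elim (v∉span ((b ·ᵥ (-ᵥ c)) , v≡))
    where
    open ≡-Reasoning
    v≡ : lincomb (b ·ᵥ (-ᵥ c)) vs ≡ v
    v≡ = begin
      lincomb (b ·ᵥ (-ᵥ c)) vs ≡⟨ lincomb-· b (-ᵥ c) vs ⟩
      b ·ᵥ lincomb (-ᵥ c) vs   ≡⟨ cong (b ·ᵥ_) (lincomb-· (- 1#) c vs) ⟩
      b ·ᵥ (-ᵥ lincomb c vs)   ≡⟨ cong (b ·ᵥ_) (sym (+ᵥ≡0⇒≡-ᵥ (a ·ᵥ v) (lincomb c vs) e)) ⟩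
      b ·ᵥ (a ·ᵥ v)            ≡⟨ ·ᵥ-assoc b a v ⟩
      (b * a) ·ᵥ v             ≡⟨ cong (_·ᵥ v) (trans (*-comm b a) ab≡1) ⟩
      1# ·ᵥ v                  ≡⟨ ·ᵥ-identity v ⟩
      v ∎

  independent? : ∀ {n d} → Vec (Vector n) d → Bool
  independent? []       = true
  independent? (v ∷ vs) = independent? vs ∧ not (span vs v)

  independent?-sound : ∀ {n d} (vs : Vec (Vector n) d) → independent? vs ≡ true → Independent vs
  independent?-sound []       _ = []-independent
  independent?-sound (v ∷ vs) e with ∧-true⁻ {independent? vs} e
  ... | vs-indep , v∉ = Independent-∷⁺ v vs (independent?-sound vs vs-indep) (span-false vs v (not-true⁻ v∉))

  independent?-complete : ∀ {n d} (vs : Vec (Vector n) d) → Independent vs → independent? vs ≡ true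
  independent?-complete []       h = refl
  independent?-complete (v ∷ vs) h with Independent-∷⁻ v vs h
  ... | vs-indep , v∉ with span vs v in v∈?
  ... | true  = ⊥-elim (v∉ (span-sound vs v v∈?))
  ... | false rewrite independent?-complete vs vs-indep = refl

  independent?-++[] : ∀ {n d} (xs : Vec (Vector n) d) → independent? (xs ++ []) ≡ independent? xs
  independent?-++[] []       = refl
  independent?-++[] (x ∷ xs) rewrite independent?-++[] xs | span-++[] xs x = refl

  lincomb-injective : ∀ {n d} (vs : Vec (Vector n) d) → Independent vs → ∀ c c′ → lincomb c vs ≡ lincomb c′ vs → c ≡ c′
  lincomb-injective vs indep c c′ e = x+-y≡0⇒x≡y c c′ (indep _ (begin
    lincomb (c +ᵥ (-ᵥ c′)) vs                ≡⟨ lincomb-+ c (-ᵥ c′) vs ⟩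
    lincomb c vs +ᵥ lincomb (-ᵥ c′) vs       ≡⟨ cong₂ _+ᵥ_ e (lincomb-· (- 1#) c′ vs) ⟩
    lincomb c′ vs +ᵥ (-ᵥ lincomb c′ vs)      ≡⟨ -ᵥ-inverseʳ _ ⟩
    zeroV ∎))
    where open ≡-Reasoning

  -- Each vector of the span is counted once, through its unique coordinate vector.
  card-span : ∀ {n d} (vs : Vec (Vector n) d) → Independent vs → card (span vs) ≡ q ^ d
  card-span {n} {d} vs indep = begin
    count (span vs) (vectors n)                                       ≡⟨ sumL-cong (vectors n) coordinates ⟩
    sumL (λ v → sumL (λ c → hits c v) (vectors d)) (vectors n)         ≡⟨ sumL-swap (λ v c → hits c v) (vectors n) (vectors d) ⟩
    sumL (λ c → sumL (hits c) (vectors n)) (vectors d)                 ≡⟨ sumL-cong (vectors d) (λ c → vectors-enumerates n (lincomb c vs)) ⟩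
    count (λ _ → true) (vectors d)                                    ≡⟨ count-vectors d ⟩
    q ^ d ∎
    where
    open ≡-Reasoning
    hits : Vector d → Vector n → ℕ
    hits c v = 𝟙 (does (v ≟V lincomb c vs))
    coordinates : ∀ v → 𝟙 (span vs v) ≡ sumL (λ c → hits c v) (vectors d)
    coordinates v with span vs v in v∈?
    ... | false = sym (sumL-zero _ (vectors d) λ c → cong 𝟙 (dec-false (v ≟V lincomb c vs) (span-false vs v v∈? ∘ (c ,_) ∘ sym)))
    ... | true with span-sound vs v v∈?
    ... | c₀ , refl = sym (trans (sumL-point _≟V_ {vectors d} (vectors-enumerates d) (λ c → hits c v) c₀ other)
                                 (cong 𝟙 (dec-true (v ≟V v) refl)))
      where
      other : ∀ c → c ≢ c₀ → hits c (lincomb c₀ vs) ≡ 0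
      other c c≢c₀ = cong 𝟙 (dec-false (lincomb c₀ vs ≟V lincomb c vs) (c≢c₀ ∘ sym ∘ lincomb-injective vs indep c₀ c))

  basis⇒HasDim : ∀ {n d} (W : SubsetV n) (vs : Vec (Vector n) d) → Independent vs → W ≈ˢ span vs → HasDim W d
  basis⇒HasDim W vs indep W≈span = vs , Independent⇒LinIndep vs indep ,
    λ v → mk⇔ (span-sound vs v ∘ trans (sym (W≈span v))) (trans (W≈span v) ∘ span-complete vs v)

  span-HasDim : ∀ {n d} (vs : Vec (Vector n) d) → Independent vs → HasDim (span vs) d
  span-HasDim vs indep = basis⇒HasDim (span vs) vs indep (λ _ → refl)

  HasDim⇒≈span : ∀ {n} (W : SubsetV n) d → (hd : HasDim W d) → W ≈ˢ span (proj₁ hd)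
  HasDim⇒≈span W d (vs , _ , spans) v = bool-ext (span-complete vs v ∘ Equivalence.to (spans v))
                                                 (Equivalence.from (spans v) ∘ span-sound vs v)

  card-HasDim : ∀ {n} (W : SubsetV n) d → HasDim W d → card W ≡ q ^ d
  card-HasDim {n} W d hd@(vs , li , _) =
    trans (count-cong (vectors n) (HasDim⇒≈span W d hd)) (card-span vs (LinIndep⇒Independent vs li))

  HasDim-unique : ∀ {n} (W : SubsetV n) d d′ → HasDim W d → HasDim W d′ → d ≡ d′
  HasDim-unique W d d′ h h′ = ^-injectiveʳ 1<q d d′ (trans (sym (card-HasDim W d h)) (card-HasDim W d′ h′))

  independent-in⇒≤dim : ∀ {n k} (W : SubsetV n) d → IsSubspace W → HasDim W d → (ws : Vec (Vector n) k) →
    Independent ws → allIn W ws ≡ true → k ≤ d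
  independent-in⇒≤dim {n} {k} W d S hd ws indep ws⊆W = ^-cancelˡ-≤ 1<q k d (begin
    q ^ k          ≡⟨ sym (card-span ws indep) ⟩
    card (span ws) ≤⟨ count-mono _ _ (vectors n) (span-⊆ W S ws ws⊆W) ⟩
    card W         ≡⟨ card-HasDim W d hd ⟩
    q ^ d ∎)
    where open ℕP.≤-Reasoning

  independent⇒≤n : ∀ {n k} (ws : Vec (Vector n) k) → Independent ws → k ≤ n
  independent⇒≤n {n} {k} ws indep = ^-cancelˡ-≤ 1<q k n (begin
    q ^ k                           ≡⟨ sym (card-span ws indep) ⟩
    card (span ws)                  ≤⟨ count-mono _ (λ _ → true) (vectors n) (λ _ _ → refl) ⟩
    count (λ _ → true) (vectors n)  ≡⟨ count-vectors n ⟩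
    q ^ n ∎)
    where open ℕP.≤-Reasoning

  -- Equal cardinalities force the inclusion span ws ⊆ W to be an equality.
  independent-in⇒spans : ∀ {n d} (W : SubsetV n) → IsSubspace W → HasDim W d → (ws : Vec (Vector n) d) →
    Independent ws → allIn W ws ≡ true → W ≈ˢ span ws
  independent-in⇒spans {n} {d} W S hd ws indep ws⊆W v = bool-ext
    (count-≡⇒⊇ (span ws) W (vectors n) (span-⊆ W S ws ws⊆W)
               (trans (card-span ws indep) (sym (card-HasDim W d hd))) v (∈-vectors v))
    (span-⊆ W S ws ws⊆W v)

  allIn≡spans : ∀ {n d} (W : SubsetV n) → IsSubspace W → HasDim W d → (ws : Vec (Vector n) d) →
    Independent ws → allIn W ws ≡ (span ws ≈? W)
  allIn≡spans W S hd ws indep = bool-ext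
    (λ ws⊆W → ≈?-complete _ _ (sym ∘ independent-in⇒spans W S hd ws indep ws⊆W))
    (λ e → lookup-allIn W ws (λ i → trans (sym (≈?-sound _ _ e (lookup ws i))) (span-lookup ws i)))

  apply-span-⊆ : ∀ {n d} (T : Matrix n) (Z : SubsetV n) → IsSubspace Z → (vs : Vec (Vector n) d) →
    allIn Z (Vec.map (apply T) vs) ≡ true → ∀ v → span vs v ≡ true → Z (apply T v) ≡ true
  apply-span-⊆ T Z S vs Tvs⊆Z v v∈ with span-sound vs v v∈
  ... | c , refl = subst (λ y → Z y ≡ true) (sym (apply-lincomb T c vs)) (lincomb-∈ Z S _ Tvs⊆Z c)

  outside? : ∀ {n d} (K : SubsetV n) (ws : Vec (Vector n) d) →
    (∃[ v ] (K v ≡ true × span ws v ≡ false)) ⊎ (∀ v → K v ≡ true → span ws v ≡ true)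
  outside? {n} K ws with any? (λ v → K v ∧ not (span ws v) Bool.≟ true) (vectors n)
  ... | yes found = let (v , e) = satisfied found ; (v∈K , v∉) = ∧-true⁻ e in inj₁ (v , v∈K , not-true⁻ v∉)
  ... | no none = inj₂ in-span
    where
    in-span : ∀ v → K v ≡ true → span ws v ≡ true
    in-span v v∈K with span ws v in v∈?
    ... | true  = refl
    ... | false = ⊥-elim (none (lose (∈-vectors v) (cong₂ _∧_ v∈K (cong not v∈?))))

  record BasisExtension {n k} (K : SubsetV n) (ws : Vec (Vector n) k) : Set where
    field
      #added   : ℕ
      added    : Vec (Vector n) #added
      indep    : Independent (added ++ ws)
      added⊆K  : allIn K added ≡ true
      spans    : K ≈ˢ span (added ++ ws)

  -- Greedily adjoin vectors of K outside the current span; by independent⇒≤n this stops within n steps.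
  opaque
    extendToBasis : ∀ {n k} (K : SubsetV n) → IsSubspace K → (ws : Vec (Vector n) k) → Independent ws →
      allIn K ws ≡ true → BasisExtension K ws
    extendToBasis {n} {k} K S ws ws-indep ws⊆K = go n [] (ℕP.m≤n+m n k) ws-indep ws⊆K
      where
      go : ∀ {j} (fuel : ℕ) (ys : Vec (Vector n) j) → n ≤ (j ℕ.+ k) ℕ.+ fuel →
           Independent (ys ++ ws) → allIn K (ys ++ ws) ≡ true → BasisExtension K ws
      go {j} fuel ys bound indep ⊆K with outside? K (ys ++ ws)
      ... | inj₂ K⊆span = record
        { added = ys ; indep = indep ; added⊆K = proj₁ (∧-true⁻ (trans (sym (allIn-++ K ys ws)) ⊆K))
        ; spans = λ v → bool-ext (K⊆span v) (span-⊆ K S (ys ++ ws) ⊆K v) }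
      ... | inj₁ (v , v∈K , v∉) with Independent-∷⁺ v (ys ++ ws) indep (span-false (ys ++ ws) v v∉) | fuel
      ... | indep′ | zero = ⊥-elim (ℕP.<-irrefl refl (ℕP.≤-trans (independent⇒≤n (v ∷ (ys ++ ws)) indep′)
                                                            (ℕP.≤-trans bound (ℕP.≤-reflexive (ℕP.+-identityʳ _)))))
      ... | indep′ | suc fuel = go fuel (v ∷ ys) (ℕP.≤-trans bound (ℕP.≤-reflexive (ℕP.+-suc _ fuel))) indep′ (∧-true⁺ v∈K ⊆K)

    dim : ∀ {n} (K : SubsetV n) → IsSubspace K → ℕ
    dim K S = BasisExtension.#added (extendToBasis K S [] []-independent refl)

    dim-HasDim : ∀ {n} (K : SubsetV n) (S : IsSubspace K) → HasDim K (dim K S)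
    dim-HasDim K S = subst (HasDim K) (ℕP.+-identityʳ _) (basis⇒HasDim K (added ++ []) indep spans)
      where open BasisExtension (extendToBasis K S [] []-independent refl)

  dim-unique : ∀ {n} (K : SubsetV n) (S : IsSubspace K) d → HasDim K d → dim K S ≡ d
  dim-unique K S d = HasDim-unique K (dim K S) d (dim-HasDim K S)

module TupleCounting (F : FiniteField) where
  open ListSums
  open FieldVectors F
  open Subspaces F
  open QArithmetic q using (extensions; bases; bases-pos)

  tuples : ∀ n k → List (Vec (Vector n) k)
  tuples n k = vecsOver (vectors n) k

  count-outside-span : ∀ {n m} (R : SubsetV n) → IsSubspace R → ∀ r → card R ≡ q ^ r →
    (Z : Vec (Vector n) m) → Independent Z → allIn R Z ≡ true →
    count (λ y → R y ∧ not (span Z y)) (vectors n) ≡ q ^ r ∸ q ^ m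
  count-outside-span {n} {m} R S r card-R Z indep Z⊆R = begin
    count (λ y → R y ∧ not (span Z y)) (vectors n)   ≡⟨ sym (ℕP.m+n∸m≡n inside _) ⟩
    inside ℕ.+ count (λ y → R y ∧ not (span Z y)) (vectors n) ∸ inside
                                                     ≡⟨ cong₂ _∸_ (sym (count-∧-split R (span Z) (vectors n))) card-inside ⟩
    card R ∸ q ^ m                                   ≡⟨ cong (_∸ q ^ m) card-R ⟩
    q ^ r ∸ q ^ m ∎
    where
    open ≡-Reasoning
    inside = count (λ y → R y ∧ span Z y) (vectors n)
    span⊆R : ∀ y → R y ∧ span Z y ≡ span Z y
    span⊆R y with span Z y in y∈?
    ... | true rewrite span-⊆ R S Z Z⊆R y y∈? = refl
    ... | false = BoolP.∧-zeroʳ (R y)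
    card-inside : inside ≡ q ^ m
    card-inside = trans (count-cong (vectors n) span⊆R) (card-span Z indep)

  -- Choosing the k new vectors one at a time, the next one ranges over R minus a span of dimension (k + s).
  count-extensions : ∀ {n s} (R : SubsetV n) → IsSubspace R → ∀ r → card R ≡ q ^ r →
    (B : Vec (Vector n) s) → Independent B → allIn R B ≡ true →
    ∀ k → count (λ x → allIn R x ∧ independent? (x ++ B)) (tuples n k) ≡ extensions r s k
  count-extensions R S r card-R B indep B⊆R zero rewrite independent?-complete B indep = refl
  count-extensions {n} {s} R S r card-R B indep B⊆R (suc k) = begin
    count (λ x → allIn R x ∧ independent? (x ++ B)) (tuples n (suc k))
      ≡⟨ sumL-vecsOver (vectors n) k _ ⟩
    sumL (λ y → sumL (λ x → 𝟙 (good (y ∷ x))) (tuples n k)) (vectors n)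
      ≡⟨ sumL-swap (λ y x → 𝟙 (good (y ∷ x))) (vectors n) (tuples n k) ⟩
    sumL (λ x → count (λ y → good (y ∷ x)) (vectors n)) (tuples n k)
      ≡⟨ sumL-indicator good _ (q ^ r ∸ q ^ (k ℕ.+ s)) (tuples n k) next-good next-bad ⟩
    count good (tuples n k) ℕ.* (q ^ r ∸ q ^ (k ℕ.+ s))
      ≡⟨ cong (ℕ._* (q ^ r ∸ q ^ (k ℕ.+ s))) (count-extensions R S r card-R B indep B⊆R k) ⟩
    extensions r s k ℕ.* (q ^ r ∸ q ^ (k ℕ.+ s)) ∎
    where
    open ≡-Reasoning
    good : ∀ {j} → Vec (Vector n) j → Bool
    good x = allIn R x ∧ independent? (x ++ B)
    next-good : ∀ (x : Vec (Vector n) k) → good x ≡ true → count (λ y → good (y ∷ x)) (vectors n) ≡ q ^ r ∸ q ^ (k ℕ.+ s)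
    next-good x e with ∧-true⁻ e
    ... | x⊆R , x++B-indep = trans (count-cong (vectors n) simplify)
      (count-outside-span R S r card-R (x ++ B) (independent?-sound _ x++B-indep)
                          (trans (allIn-++ R x B) (∧-true⁺ x⊆R B⊆R)))
      where
      simplify : ∀ y → (R y ∧ allIn R x) ∧ (independent? (x ++ B) ∧ not (span (x ++ B) y)) ≡ R y ∧ not (span (x ++ B) y)
      simplify y = absorb (allIn R x) (independent? (x ++ B)) (R y) _ x⊆R x++B-indep
        where
        absorb : ∀ a b r c → a ≡ true → b ≡ true → (r ∧ a) ∧ (b ∧ c) ≡ r ∧ c
        absorb true true r c _ _ = cong (_∧ c) (BoolP.∧-identityʳ r)
    next-bad : ∀ (x : Vec (Vector n) k) → good x ≡ false → count (λ y → good (y ∷ x)) (vectors n) ≡ 0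
    next-bad x e = count-none _ (vectors n) vanish
      where
      vanish : ∀ y → (R y ∧ allIn R x) ∧ (independent? (x ++ B) ∧ not (span (x ++ B) y)) ≡ false
      vanish y with allIn R x | independent? (x ++ B)
      ... | true  | true  = ⊥-elim (true≢false refl e)
      ... | true  | false = BoolP.∧-zeroʳ (R y ∧ true)
      ... | false | _     = cong (_∧ _) (BoolP.∧-zeroʳ (R y))

  count-bases : ∀ {n} (W : SubsetV n) d → IsSubspace W → HasDim W d →
    count (λ w → independent? w ∧ (span w ≈? W)) (tuples n d) ≡ bases d
  count-bases {n} W d S hd = trans (count-cong (tuples n d) spans⇔⊆)
    (count-extensions W S d (card-HasDim W d hd) [] []-independent refl d)
    where
    spans⇔⊆ : ∀ w → independent? w ∧ (span w ≈? W) ≡ allIn W w ∧ independent? (w ++ [])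
    spans⇔⊆ w rewrite independent?-++[] w with independent? w in w-indep
    ... | false = sym (BoolP.∧-zeroʳ _)
    ... | true  = trans (sym (allIn≡spans W S hd w (independent?-sound w w-indep))) (sym (BoolP.∧-identityʳ _))

  SpanInvariant : ∀ {n a} → (Vec (Vector n) a → Bool) → Set
  SpanInvariant {n} {a} Q = ∀ (w w′ : Vec (Vector n) a) → independent? w ≡ true → independent? w′ ≡ true →
    span w ≈ˢ span w′ → Q w ≡ Q w′

  module _ {n a} (Q : Vec (Vector n) a → Bool) (w₀ : Vec (Vector n) a) where

    withoutSpanOf : Vec (Vector n) a → Bool
    withoutSpanOf w = Q w ∧ not (span w ≈? span w₀)

    SpanInvariant-withoutSpanOf : SpanInvariant Q → SpanInvariant withoutSpanOf
    SpanInvariant-withoutSpanOf inv w w′ w-indep w′-indep w≈w′ =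
      cong₂ (λ x y → x ∧ not y) (inv w w′ w-indep w′-indep w≈w′) (bool-ext
        (λ e → ≈?-complete _ _ λ v → trans (sym (w≈w′ v)) (≈?-sound _ _ e v))
        (λ e → ≈?-complete _ _ λ v → trans (w≈w′ v) (≈?-sound _ _ e v)))

    count-withoutSpanOf : SpanInvariant Q → independent? w₀ ≡ true → Q w₀ ≡ true →
      count (λ w → independent? w ∧ Q w) (tuples n a)
        ≡ bases a ℕ.+ count (λ w → independent? w ∧ withoutSpanOf w) (tuples n a)
    count-withoutSpanOf inv w₀-indep Q-w₀ = trans (count-∧-split _ (λ w → span w ≈? span w₀) (tuples n a))
      (cong₂ ℕ._+_ (trans (count-cong (tuples n a) same-span)
                          (count-bases (span w₀) a (span-isSubspace w₀) (span-HasDim w₀ (independent?-sound w₀ w₀-indep))))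
                   (count-cong (tuples n a) (λ w → BoolP.∧-assoc (independent? w) (Q w) _)))
      where
      same-span : ∀ w → (independent? w ∧ Q w) ∧ (span w ≈? span w₀) ≡ independent? w ∧ (span w ≈? span w₀)
      same-span w with independent? w in w-indep | span w ≈? span w₀ in w≈w₀
      ... | true  | true  rewrite inv w w₀ w-indep w₀-indep (≈?-sound _ _ w≈w₀) | Q-w₀ = refl
      ... | true  | false = BoolP.∧-zeroʳ _
      ... | false | _     = refl

  -- Independent a-tuples fall into classes of bases of the same subspace, each of size bases a.
  count-multiple-of-bases : ∀ {n} a (Q : Vec (Vector n) a → Bool) → SpanInvariant Q →
    ∃[ N ] (count (λ w → independent? w ∧ Q w) (tuples n a) ≡ N ℕ.* bases a)
  count-multiple-of-bases {n} a Q inv = go _ Q inv ℕP.≤-refl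
    where
    go : ∀ fuel (Q : Vec (Vector n) a → Bool) → SpanInvariant Q → count (λ w → independent? w ∧ Q w) (tuples n a) ≤ fuel →
         ∃[ N ] (count (λ w → independent? w ∧ Q w) (tuples n a) ≡ N ℕ.* bases a)
    go zero Q inv bound = 0 , ℕP.n≤0⇒n≡0 bound
    go (suc fuel) Q inv bound with count (λ w → independent? w ∧ Q w) (tuples n a) in total
    ... | zero  = 0 , refl
    ... | suc c with count-pos⇒∃ _ (tuples n a) (ℕP.≤-trans (s≤s z≤n) (ℕP.≤-reflexive (sym total)))
    ... | w₀ , _ , e = peel (∧-true⁻ {independent? w₀} e)
      where
      peel : independent? w₀ ≡ true × Q w₀ ≡ true → ∃[ N ] (suc c ≡ N ℕ.* bases a)
      peel (w₀-indep , Q-w₀) = suc (proj₁ rest) , trans peeled (cong (bases a ℕ.+_) (proj₂ rest))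
        where
        peeled : suc c ≡ bases a ℕ.+ count (λ w → independent? w ∧ withoutSpanOf Q w₀ w) (tuples n a)
        peeled = trans (sym total) (count-withoutSpanOf Q w₀ inv w₀-indep Q-w₀)
        rest≤fuel = ℕP.≤-pred (ℕP.≤-trans (ℕP.+-monoˡ-≤ _ (bases-pos 1<q a)) (ℕP.≤-trans (ℕP.≤-reflexive (sym peeled)) bound))
        rest = go fuel (withoutSpanOf Q w₀) (SpanInvariant-withoutSpanOf Q w₀ inv) rest≤fuel

  anyᵥ : ∀ {A : Set} {N} → (A → Bool) → Vec A N → Bool
  anyᵥ p []       = false
  anyᵥ p (x ∷ xs) = p x ∨ anyᵥ p xs

  anyᵥ-sound : ∀ {A : Set} {N} (p : A → Bool) (xs : Vec A N) → anyᵥ p xs ≡ true → ∃[ i ] (p (lookup xs i) ≡ true)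
  anyᵥ-sound p (x ∷ xs) e with p x in px
  ... | true  = zero , px
  ... | false with anyᵥ-sound p xs e
  ... | i , e′ = suc i , e′

  anyᵥ-complete : ∀ {A : Set} {N} (p : A → Bool) (xs : Vec A N) i → p (lookup xs i) ≡ true → anyᵥ p xs ≡ true
  anyᵥ-complete p (x ∷ xs) zero    e rewrite e = refl
  anyᵥ-complete p (x ∷ xs) (suc i) e rewrite anyᵥ-complete p xs i e = BoolP.∨-zeroʳ (p x)

  count-bases-of-some : ∀ {n} a {N} (Ws : Vec (SubsetV n) N) →
    (∀ i → IsSubspace (lookup Ws i) × HasDim (lookup Ws i) a) →
    (∀ i j → lookup Ws i ≈ˢ lookup Ws j → i ≡ j) →
    count (λ w → independent? w ∧ anyᵥ (span w ≈?_) Ws) (tuples n a) ≡ N ℕ.* bases a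
  count-bases-of-some {n} a []       _       _        = count-none _ (tuples n a) (λ w → BoolP.∧-zeroʳ (independent? w))
  count-bases-of-some {n} a (W ∷ Ws) subspace distinct =
    trans (count-cong (tuples n a) (λ w → BoolP.∧-distribˡ-∨ (independent? w) _ _))
      (trans (count-∨-disjoint _ _ (tuples n a) disjoint)
        (cong₂ ℕ._+_ (count-bases W a (proj₁ (subspace zero)) (proj₂ (subspace zero)))
                     (count-bases-of-some a Ws (subspace ∘ suc) (λ i j e → FinP.suc-injective (distinct (suc i) (suc j) e)))))
    where
    disjoint : ∀ w → (independent? w ∧ (span w ≈? W)) ∧ (independent? w ∧ anyᵥ (span w ≈?_) Ws) ≡ false
    disjoint w with span w ≈? W in w≈W | anyᵥ (span w ≈?_) Ws in w∈Ws
    ... | true | true with anyᵥ-sound _ Ws w∈Ws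
    ...   | j , w≈Wⱼ with distinct zero (suc j) (λ v → trans (sym (≈?-sound _ _ w≈W v)) (≈?-sound _ _ w≈Wⱼ v))
    ...     | ()
    disjoint w | true  | false = trans (cong ((independent? w ∧ true) ∧_) (BoolP.∧-zeroʳ (independent? w)))
                                       (BoolP.∧-zeroʳ (independent? w ∧ true))
    disjoint w | false | b     = cong (_∧ (independent? w ∧ b)) (BoolP.∧-zeroʳ (independent? w))

  HasCount⇒count : ∀ {n} a (P : SubsetV n → Set) N → HasCount P N →
    (∀ W → P W → IsSubspace W × HasDim W a) →
    (∀ W W′ → W ≈ˢ W′ → P W → P W′) →
    (Q : Vec (Vector n) a → Bool) →
    (∀ w → independent? w ≡ true → Q w ≡ true ⇔ P (span w)) →
    count (λ w → independent? w ∧ Q w) (tuples n a) ≡ N ℕ.* bases a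
  HasCount⇒count {n} a P N (Ws , P-Ws , distinct , complete) subspace P-≈ Q Q⇔P =
    trans (count-cong (tuples n a) Q≡listed) (count-bases-of-some a Ws (λ i → subspace _ (P-Ws i)) distinct)
    where
    Q≡listed : ∀ w → independent? w ∧ Q w ≡ independent? w ∧ anyᵥ (span w ≈?_) Ws
    Q≡listed w with independent? w in w-indep
    ... | false = refl
    ... | true  = bool-ext
      (λ Q-w → let (i , e) = complete _ (Equivalence.to (Q⇔P w w-indep) Q-w) in anyᵥ-complete _ Ws i (≈?-complete _ _ e))
      (λ listed → let (i , e) = anyᵥ-sound _ Ws listed in
                  Equivalence.from (Q⇔P w w-indep) (P-≈ _ _ (λ v → sym (≈?-sound _ _ e v)) (P-Ws i)))

module ContainingSubspaces (F : FiniteField) (n : ℕ) where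
  open ListSums
  open FieldVectors F
  open Subspaces F
  open TupleCounting F
  open QArithmetic q using (gauss; extensions; bases; gauss*extensions; extensions-pos)

  -- the number of a-dimensional subspaces of F^n containing a given s-dimensional one
  containing : ℕ → ℕ → ℕ
  containing a s = if does (s ℕ.≤? a) then gauss (n ∸ s) (a ∸ s) else 0

  containing-≰ : ∀ {a s} → ¬ s ≤ a → containing a s ≡ 0
  containing-≰ {a} {s} s≰a = cong (if_then gauss (n ∸ s) (a ∸ s) else 0) (dec-false (s ℕ.≤? a) s≰a)

  containing-≤ : ∀ {a s} → s ≤ a → containing a s ≡ gauss (n ∸ s) (a ∸ s)
  containing-≤ {a} {s} s≤a = cong (if_then gauss (n ∸ s) (a ∸ s) else 0) (dec-true (s ℕ.≤? a) s≤a)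

  full-isSubspace : IsSubspace {n} (λ _ → true)
  full-isSubspace = refl , (λ _ _ _ _ → refl) , (λ _ _ _ → refl)

  module _ {s} (Sb : Vec (Vector n) s) (Sb-indep : Independent Sb) where

    Contains : ∀ {a} → Vec (Vector n) a → Bool
    Contains w = independent? w ∧ allIn (span w) Sb

    count-Contains-too-big : ∀ a → ¬ s ≤ a → count Contains (tuples n a) ≡ 0
    count-Contains-too-big a s≰a = count-none _ (tuples n a) none
      where
      none : ∀ w → Contains w ≡ false
      none w with independent? w in w-indep | allIn (span w) Sb in Sb⊆w
      ... | true  | true  = ⊥-elim (s≰a (independent-in⇒≤dim (span w) a (span-isSubspace w)
                                        (span-HasDim w (independent?-sound w w-indep)) Sb Sb-indep Sb⊆w))
      ... | true  | false = refl
      ... | false | _     = refl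

    module _ a (s≤a : s ≤ a) where
      private
        k = a ∸ s
        k+s≡a : k ℕ.+ s ≡ a
        k+s≡a = ℕP.m∸n+n≡m s≤a

      Pair : Vec (Vector n) a → Vec (Vector n) k → Bool
      Pair w x = Contains w ∧ (allIn (span w) x ∧ independent? (x ++ Sb))

      count-Pair-by-basis : sumL (λ w → count (Pair w) (tuples n k)) (tuples n a)
                              ≡ count Contains (tuples n a) ℕ.* extensions a s k
      count-Pair-by-basis = sumL-indicator Contains _ _ (tuples n a) extend none
        where
        extend : ∀ w → Contains w ≡ true → count (Pair w) (tuples n k) ≡ extensions a s k
        extend w e with ∧-true⁻ {independent? w} e
        ... | w-indep , Sb⊆w rewrite e = count-extensions (span w) (span-isSubspace w)
                a (card-span w (independent?-sound w w-indep)) Sb Sb-indep Sb⊆w k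
        none : ∀ w → Contains w ≡ false → count (Pair w) (tuples n k) ≡ 0
        none w e rewrite e = count-none _ (tuples n k) (λ _ → refl)

      bases-of-span : ∀ x → independent? (x ++ Sb) ≡ true →
        ∀ w → Pair w x ≡ independent? w ∧ (span w ≈? span (x ++ Sb))
      bases-of-span x x++Sb-indep w with independent? w in w-indep
      ... | false = refl
      ... | true  rewrite x++Sb-indep = begin
        allIn (span w) Sb ∧ (allIn (span w) x ∧ true) ≡⟨ cong (allIn (span w) Sb ∧_) (BoolP.∧-identityʳ _) ⟩
        allIn (span w) Sb ∧ allIn (span w) x          ≡⟨ BoolP.∧-comm (allIn (span w) Sb) _ ⟩
        allIn (span w) x ∧ allIn (span w) Sb          ≡⟨ sym (allIn-++ (span w) x Sb) ⟩
        allIn (span w) (x ++ Sb)                      ≡⟨ allIn≡spans (span w) (span-isSubspace w) span-w-HasDim (x ++ Sb) x++Sb-indep′ ⟩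
        span (x ++ Sb) ≈? span w                      ≡⟨ ≈?-sym (span (x ++ Sb)) (span w) ⟩
        span w ≈? span (x ++ Sb) ∎
        where
        open ≡-Reasoning
        x++Sb-indep′ = independent?-sound (x ++ Sb) x++Sb-indep
        span-w-HasDim : HasDim (span w) (k ℕ.+ s)
        span-w-HasDim = subst (HasDim (span w)) (sym k+s≡a) (span-HasDim w (independent?-sound w w-indep))

      count-Pair-by-extension : sumL (λ x → count (λ w → Pair w x) (tuples n a)) (tuples n k)
                                  ≡ extensions n s k ℕ.* bases a
      count-Pair-by-extension =
        trans (sumL-indicator (λ x → independent? (x ++ Sb)) _ _ (tuples n k) bases-count none)
              (cong (ℕ._* bases a) (trans (count-cong (tuples n k) (λ x → cong (_∧ independent? (x ++ Sb)) (sym (allIn-full x))))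
                                          (count-extensions (λ _ → true) full-isSubspace n (count-vectors n) Sb Sb-indep (allIn-full Sb) k)))
        where
        bases-count : ∀ x → independent? (x ++ Sb) ≡ true → count (λ w → Pair w x) (tuples n a) ≡ bases a
        bases-count x e = trans (count-cong (tuples n a) (bases-of-span x e))
          (count-bases (span (x ++ Sb)) a (span-isSubspace (x ++ Sb))
                       (subst (HasDim (span (x ++ Sb))) k+s≡a (span-HasDim (x ++ Sb) (independent?-sound (x ++ Sb) e))))
        none : ∀ x → independent? (x ++ Sb) ≡ false → count (λ w → Pair w x) (tuples n a) ≡ 0
        none x e = count-none _ (tuples n a) λ w →
          trans (cong (λ b → Contains w ∧ (allIn (span w) x ∧ b)) e)
                (trans (cong (Contains w ∧_) (BoolP.∧-zeroʳ _)) (BoolP.∧-zeroʳ _))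

    count-Contains : ∀ a → a ≤ n → count Contains (tuples n a) ≡ containing a s ℕ.* bases a
    count-Contains a a≤n with s ℕ.≤? a
    ... | no s≰a = trans (count-Contains-too-big a s≰a) (cong (ℕ._* bases a) (sym (containing-≰ s≰a)))
    ... | yes s≤a = trans (ℕP.*-cancelʳ-≡ _ _ (extensions a s k) {{ℕ.>-nonZero ext-pos}} (begin
      count Contains (tuples n a) ℕ.* extensions a s k
        ≡⟨ sym (count-Pair-by-basis a s≤a) ⟩
      sumL (λ w → count (Pair a s≤a w) (tuples n k)) (tuples n a)
        ≡⟨ sumL-swap (λ w x → 𝟙 (Pair a s≤a w x)) (tuples n a) (tuples n k) ⟩
      sumL (λ x → count (λ w → Pair a s≤a w x) (tuples n a)) (tuples n k)
        ≡⟨ count-Pair-by-extension a s≤a ⟩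
      extensions n s k ℕ.* bases a
        ≡⟨ cong (ℕ._* bases a) (sym (gauss*extensions 1≤q n a s s≤a a≤n)) ⟩
      gauss (n ∸ s) k ℕ.* extensions a s k ℕ.* bases a
        ≡⟨ swap (gauss (n ∸ s) k) (extensions a s k) (bases a) ⟩
      gauss (n ∸ s) k ℕ.* bases a ℕ.* extensions a s k ∎)) (cong (ℕ._* bases a) (sym (containing-≤ s≤a)))
      where
      open ≡-Reasoning
      k = a ∸ s
      ext-pos = extensions-pos 1<q a s k (ℕP.≤-reflexive (ℕP.m∸n+n≡m s≤a))
      swap : ∀ g e b → g ℕ.* e ℕ.* b ≡ g ℕ.* b ℕ.* e
      swap = solve-∀
        where open import Data.Nat.Tactic.RingSolver using (solve-∀)

module StableCore (F : FiniteField) (n : ℕ) (T : LinAlg.Matrix F n) where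
  open ListSums
  open FieldVectors F
  open Subspaces F
  open TupleCounting F
  open ContainingSubspaces F n
  open QArithmetic q using (extensions; bases)

  core : ∀ {k} → Vec (Vector n) k → SubsetV n
  core w = span w ∩ˢ preimage T (span w)

  core-isSubspace : ∀ {k} (w : Vec (Vector n) k) → IsSubspace (core w)
  core-isSubspace w = ∧-true⁺ zero∈ (subst (λ z → span w z ≡ true) (sym (apply-zero T)) zero∈)
    , (λ u v u∈ v∈ → let (u∈W , Tu∈W) = ∧-true⁻ {span w u} u∈ ; (v∈W , Tv∈W) = ∧-true⁻ {span w v} v∈ in
          ∧-true⁺ (+∈ u v u∈W v∈W) (subst (λ z → span w z ≡ true) (sym (apply-+ T u v)) (+∈ _ _ Tu∈W Tv∈W)))
    , (λ a v v∈ → let (v∈W , Tv∈W) = ∧-true⁻ {span w v} v∈ in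
          ∧-true⁺ (·∈ a v v∈W) (subst (λ z → span w z ≡ true) (sym (apply-· T a v)) (·∈ a _ Tv∈W)))
    where open Σ (span-isSubspace w) renaming (proj₁ to zero∈; proj₂ to closed)
          open Σ closed renaming (proj₁ to +∈; proj₂ to ·∈)

  coreDim : ∀ {k} → Vec (Vector n) k → ℕ
  coreDim w = dim (core w) (core-isSubspace w)

  coreDim-HasDim : ∀ {k} (w : Vec (Vector n) k) → HasDim (core w) (coreDim w)
  coreDim-HasDim w = dim-HasDim (core w) (core-isSubspace w)

  core⊆span : ∀ {k} (w : Vec (Vector n) k) v → core w v ≡ true → span w v ≡ true
  core⊆span w v e = proj₁ (∧-true⁻ {span w v} e)

  apply-core⊆span : ∀ {k} (w : Vec (Vector n) k) v → core w v ≡ true → span w (apply T v) ≡ true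
  apply-core⊆span w v e = proj₂ (∧-true⁻ {span w v} e)

  coreBasis⊆span : ∀ {k} (w : Vec (Vector n) k) → allIn (span w) (proj₁ (coreDim-HasDim w)) ≡ true
  coreBasis⊆span w = lookup-allIn _ κ (λ i → core⊆span w _ (Equivalence.from (κ-spans (lookup κ i)) (lincomb-lookup κ i)))
    where
    κ = proj₁ (coreDim-HasDim w)
    κ-spans = proj₂ (proj₂ (coreDim-HasDim w))

  coreDim-≤ : ∀ {a} (w : Vec (Vector n) a) → independent? w ≡ true → coreDim w ≤ a
  coreDim-≤ {a} w w-indep = independent-in⇒≤dim (span w) a (span-isSubspace w)
    (span-HasDim w (independent?-sound w w-indep)) (proj₁ (coreDim-HasDim w))
    (LinIndep⇒Independent _ (proj₁ (proj₂ (coreDim-HasDim w)))) (coreBasis⊆span w)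

  core-≈ : ∀ {k} (w w′ : Vec (Vector n) k) → span w ≈ˢ span w′ → core w ≈ˢ core w′
  core-≈ w w′ w≈w′ v = cong₂ _∧_ (w≈w′ v) (w≈w′ (apply T v))

  HasCoreDim : ∀ {a} → ℕ → Vec (Vector n) a → Bool
  HasCoreDim b w = does (coreDim w ℕ.≟ b)

  HasCoreDim-invariant : ∀ {a} b → SpanInvariant {n} {a} (HasCoreDim b)
  HasCoreDim-invariant b w w′ _ _ w≈w′ = cong (λ d → does (d ℕ.≟ b))
    (dim-unique (core w) (core-isSubspace w) (coreDim w′)
      (HasDim-≈ (core w′) (core w) (coreDim w′) (sym ∘ core-≈ w w′ w≈w′) (coreDim-HasDim w′)))

  tuplesWithCoreDim : ℕ → ℕ → ℕ
  tuplesWithCoreDim a b = count (λ w → independent? w ∧ HasCoreDim b w) (tuples n a)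

  -- σ a b counts the a-dimensional W with dim (W ∩ T⁻¹W) = b: independent a-tuples with core
  -- dimension b, up to the bases a reorderings of each basis.
  opaque
    σ : ℕ → ℕ → ℕ
    σ a b = proj₁ (count-multiple-of-bases a (HasCoreDim b) (HasCoreDim-invariant b))

    tuplesWithCoreDim≡σ*bases : ∀ a b → tuplesWithCoreDim a b ≡ σ a b ℕ.* bases a
    tuplesWithCoreDim≡σ*bases a b = proj₂ (count-multiple-of-bases a (HasCoreDim b) (HasCoreDim-invariant b))

  -- Extend a basis κ of core u to a basis added ++ κ of span u; then T(added) ++ u is a basis
  -- of span (u ∪ T u), of size (c - dim core u) + c.
  module RankNullity {c} (u : Vec (Vector n) c) (u-indep : Independent u) where
    private
      e = coreDim u
      κ = proj₁ (coreDim-HasDim u)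
      κ-indep : Independent κ
      κ-indep = LinIndep⇒Independent κ (proj₁ (proj₂ (coreDim-HasDim u)))
      Tκ∈span : ∀ i → span u (apply T (lookup κ i)) ≡ true
      Tκ∈span i = apply-core⊆span u _ (Equivalence.from (proj₂ (proj₂ (coreDim-HasDim u)) (lookup κ i)) (lincomb-lookup κ i))
      extension = extendToBasis (span u) (span-isSubspace u) κ κ-indep (coreBasis⊆span u)
      open BasisExtension extension

    m : ℕ
    m = #added

    m+coreDim≡c : m ℕ.+ e ≡ c
    m+coreDim≡c = HasDim-unique (span u) (m ℕ.+ e) c (basis⇒HasDim (span u) (added ++ κ) indep spans) (span-HasDim u u-indep)

    Sb : Vec (Vector n) (m ℕ.+ c)
    Sb = Vec.map (apply T) added ++ u

    private
      added∩core : ∀ β → core u (lincomb β added) ≡ true → β ≡ zeroV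
      added∩core β y∈core = from-coordinates (Equivalence.to (proj₂ (proj₂ (coreDim-HasDim u)) (lincomb β added)) y∈core)
        where
        from-coordinates : InSpan κ (lincomb β added) → β ≡ zeroV
        from-coordinates (δ , δκ≡y) = VecP.++-injectiveˡ β zeroV (trans (indep (β ++ (-ᵥ δ)) relation) (zeroV-++ m e))
          where
          relation : lincomb (β ++ (-ᵥ δ)) (added ++ κ) ≡ zeroV
          relation = begin
            lincomb (β ++ (-ᵥ δ)) (added ++ κ)            ≡⟨ lincomb-++ β (-ᵥ δ) added κ ⟩
            lincomb β added +ᵥ lincomb (-ᵥ δ) κ           ≡⟨ cong (lincomb β added +ᵥ_) (trans (lincomb-· (- 1#) δ κ) (cong -ᵥ_ δκ≡y)) ⟩
            lincomb β added +ᵥ (-ᵥ lincomb β added)       ≡⟨ -ᵥ-inverseʳ _ ⟩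
            zeroV ∎
            where open ≡-Reasoning

    Sb-indep : Independent Sb
    Sb-indep γ′ Σ≡0 = split (Vec.splitAt m γ′)
      where
      split : (∃[ β ] ∃[ γ ] (γ′ ≡ β ++ γ)) → γ′ ≡ zeroV
      split (β , γ , γ′≡β++γ) = trans γ′≡β++γ (trans (cong₂ _++_ β≡0 γ≡0) (sym (zeroV-++ m c)))
        where
        y = lincomb β added
        Ty+γu≡0 : apply T y +ᵥ lincomb γ u ≡ zeroV
        Ty+γu≡0 = trans (cong (_+ᵥ lincomb γ u) (apply-lincomb T β added))
                        (trans (sym (lincomb-++ β γ (Vec.map (apply T) added) u)) (subst (λ γ″ → lincomb γ″ Sb ≡ zeroV) γ′≡β++γ Σ≡0))
        y∈core : core u y ≡ true
        y∈core = ∧-true⁺ (lincomb-∈ (span u) (span-isSubspace u) added added⊆K β)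
          (span-complete u (apply T y) ((-ᵥ γ) , trans (lincomb-· (- 1#) γ u) (sym (+ᵥ≡0⇒≡-ᵥ _ _ Ty+γu≡0))))
        β≡0 : β ≡ zeroV
        β≡0 = added∩core β y∈core
        Ty≡0 : apply T y ≡ zeroV
        Ty≡0 = trans (cong (λ β → apply T (lincomb β added)) β≡0) (trans (cong (apply T) (lincomb-zero added)) (apply-zero T))
        γ≡0 : γ ≡ zeroV
        γ≡0 = u-indep γ (trans (sym (+ᵥ-identityˡ _)) (trans (cong (_+ᵥ lincomb γ u) (sym Ty≡0)) Ty+γu≡0))

    Sb-spans : ∀ Z → IsSubspace Z → allIn Z u ∧ allIn Z (Vec.map (apply T) u) ≡ allIn Z Sb
    Sb-spans Z S = trans (bool-ext to from) (sym (allIn-++ Z (Vec.map (apply T) added) u))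
      where
      to : allIn Z u ∧ allIn Z (Vec.map (apply T) u) ≡ true → allIn Z (Vec.map (apply T) added) ∧ allIn Z u ≡ true
      to e = ∧-true⁺ (Equivalence.from (allIn-map Z (apply T) added)
                       (λ i → apply-span-⊆ T Z S u Tu⊆Z _ (allIn-lookup _ added added⊆K i))) u⊆Z
        where
        u⊆Z = proj₁ (∧-true⁻ {allIn Z u} e)
        Tu⊆Z = proj₂ (∧-true⁻ {allIn Z u} e)
      from : allIn Z (Vec.map (apply T) added) ∧ allIn Z u ≡ true → allIn Z u ∧ allIn Z (Vec.map (apply T) u) ≡ true
      from e = ∧-true⁺ u⊆Z (Equivalence.from (allIn-map Z (apply T) u)
                 (λ i → apply-span-⊆ T Z S (added ++ κ) T[added++κ]⊆Z _ (trans (sym (spans _)) (span-lookup u i))))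
        where
        Tadded⊆Z = proj₁ (∧-true⁻ {allIn Z (Vec.map (apply T) added)} e)
        u⊆Z = proj₂ (∧-true⁻ {allIn Z (Vec.map (apply T) added)} e)
        Tκ⊆Z : allIn Z (Vec.map (apply T) κ) ≡ true
        Tκ⊆Z = Equivalence.from (allIn-map Z (apply T) κ) (λ i → span-⊆ Z S u u⊆Z _ (Tκ∈span i))
        T[added++κ]⊆Z : allIn Z (Vec.map (apply T) (added ++ κ)) ≡ true
        T[added++κ]⊆Z = trans (cong (allIn Z) (VecP.map-++ (apply T) added κ))
                              (trans (allIn-++ Z (Vec.map (apply T) added) (Vec.map (apply T) κ)) (∧-true⁺ Tadded⊆Z Tκ⊆Z))

module DoubleCounting (F : FiniteField) (n : ℕ) (T : LinAlg.Matrix F n) where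
  open ListSums
  open FieldVectors F
  open Subspaces F
  open TupleCounting F
  open ContainingSubspaces F n
  open StableCore F n T
  open QArithmetic q using (extensions; bases)

  allIn-core : ∀ {a c} (w : Vec (Vector n) a) (u : Vec (Vector n) c) →
    allIn (core w) u ≡ allIn (span w) u ∧ allIn (span w) (Vec.map (apply T) u)
  allIn-core w []      = refl
  allIn-core w (v ∷ u) rewrite allIn-core w u = interchange (span w v) (span w (apply T v)) _ _
    where
    interchange : ∀ a b x y → (a ∧ b) ∧ (x ∧ y) ≡ (a ∧ x) ∧ (b ∧ y)
    interchange true  true  x y = refl
    interchange true  false x y = sym (BoolP.∧-zeroʳ x)
    interchange false b     x y = refl

  Incidence : ∀ {a c} → Vec (Vector n) a → Vec (Vector n) c → Bool
  Incidence w u = independent? w ∧ (allIn (core w) u ∧ independent? u)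

  count-Incidence-by-outer : ∀ {a} c (w : Vec (Vector n) a) →
    count (Incidence w) (tuples n c) ≡ 𝟙 (independent? w) ℕ.* extensions (coreDim w) 0 c
  count-Incidence-by-outer c w with independent? w
  ... | false = count-none _ (tuples n c) (λ _ → refl)
  ... | true  = trans (count-cong (tuples n c) (λ u → cong (allIn (core w) u ∧_) (sym (independent?-++[] u))))
                  (trans (count-extensions (core w) (core-isSubspace w) (coreDim w)
                            (card-HasDim (core w) (coreDim w) (coreDim-HasDim w)) [] []-independent refl c)
                         (sym (ℕP.+-identityʳ _)))

  count-Incidence-by-inner : ∀ a {c} → a ≤ n → (u : Vec (Vector n) c) →
    count (λ w → Incidence w u) (tuples n a) ≡ 𝟙 (independent? u) ℕ.* (containing a (c ℕ.+ (c ∸ coreDim u)) ℕ.* bases a)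
  count-Incidence-by-inner a {c} a≤n u = by-independence (independent? u) refl
    where
    by-independence : ∀ l → independent? u ≡ l →
      count (λ w → independent? w ∧ (allIn (core w) u ∧ l)) (tuples n a) ≡ 𝟙 l ℕ.* (containing a (c ℕ.+ (c ∸ coreDim u)) ℕ.* bases a)
    by-independence false _ = count-none _ (tuples n a) (λ w →
      trans (cong (independent? w ∧_) (BoolP.∧-zeroʳ (allIn (core w) u))) (BoolP.∧-zeroʳ (independent? w)))
    by-independence true u-indep = begin
      count (λ w → independent? w ∧ (allIn (core w) u ∧ true)) (tuples n a)
        ≡⟨ count-cong (tuples n a) (λ w → cong (independent? w ∧_) (trans (BoolP.∧-identityʳ _)
                                           (trans (allIn-core w u) (Sb-spans (span w) (span-isSubspace w))))) ⟩
      count (Contains Sb Sb-indep) (tuples n a)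
        ≡⟨ count-Contains Sb Sb-indep a a≤n ⟩
      containing a (m ℕ.+ c) ℕ.* bases a
        ≡⟨ cong (λ s → containing a s ℕ.* bases a) m+c≡ ⟩
      containing a (c ℕ.+ (c ∸ coreDim u)) ℕ.* bases a
        ≡⟨ sym (ℕP.+-identityʳ _) ⟩
      𝟙 true ℕ.* (containing a (c ℕ.+ (c ∸ coreDim u)) ℕ.* bases a) ∎
      where
      open ≡-Reasoning
      open RankNullity u (independent?-sound u u-indep)
      m+c≡ : m ℕ.+ c ≡ c ℕ.+ (c ∸ coreDim u)
      m+c≡ = trans (ℕP.+-comm m c) (cong (c ℕ.+_) (sym (trans (cong (_∸ coreDim u) (sym m+coreDim≡c)) (ℕP.m+n∸n≡m m (coreDim u)))))

  -- Count the incidences first by w (grouped by b = dim core w) and then by u (grouped by e = dim core u).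
  double-count : ∀ a c → a ≤ n →
    sumL (λ b → tuplesWithCoreDim a b ℕ.* extensions b 0 c) (List.upTo (suc a))
      ≡ sumL (λ e → tuplesWithCoreDim c e ℕ.* (containing a (c ℕ.+ (c ∸ e)) ℕ.* bases a)) (List.upTo (suc c))
  double-count a c a≤n = begin
    sumL (λ b → tuplesWithCoreDim a b ℕ.* extensions b 0 c) (List.upTo (suc a))
      ≡⟨ sym (sumL-byValue (tuples n a) independent? coreDim (λ b → extensions b 0 c) (suc a) (λ w → s≤s ∘ coreDim-≤ w)) ⟩
    sumL (λ w → 𝟙 (independent? w) ℕ.* extensions (coreDim w) 0 c) (tuples n a)
      ≡⟨ sumL-cong (tuples n a) (λ w → sym (count-Incidence-by-outer c w)) ⟩
    sumL (λ w → count (Incidence w) (tuples n c)) (tuples n a)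
      ≡⟨ sumL-swap (λ w u → 𝟙 (Incidence w u)) (tuples n a) (tuples n c) ⟩
    sumL (λ u → count (λ w → Incidence w u) (tuples n a)) (tuples n c)
      ≡⟨ sumL-cong (tuples n c) (count-Incidence-by-inner a a≤n) ⟩
    sumL (λ u → 𝟙 (independent? u) ℕ.* (containing a (c ℕ.+ (c ∸ coreDim u)) ℕ.* bases a)) (tuples n c)
      ≡⟨ sumL-byValue (tuples n c) independent? coreDim (λ e → containing a (c ℕ.+ (c ∸ e)) ℕ.* bases a) (suc c) (λ u → s≤s ∘ coreDim-≤ u) ⟩
    sumL (λ e → tuplesWithCoreDim c e ℕ.* (containing a (c ℕ.+ (c ∸ e)) ℕ.* bases a)) (List.upTo (suc c)) ∎
    where open ≡-Reasoning

module SigmaRecursion (F : FiniteField) (n : ℕ) (T : LinAlg.Matrix F n) where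
  open ListSums
  open FieldVectors F using (q; 1≤q; 1<q)
  open ContainingSubspaces F n using (containing)
  open StableCore F n T using (σ; tuplesWithCoreDim≡σ*bases)
  open DoubleCounting F n T using (double-count)
  open QArithmetic q using (gauss; gauss-vanishes; gauss-diag; bases; bases-pos; extensions≡gauss*bases)
  open import Data.Nat.Tactic.RingSolver using (solve-∀)

  σ-relation : ∀ a c → a ≤ n →
    sumL (λ b → σ a b ℕ.* gauss b c) (List.upTo (suc a)) ≡ sumL (λ e → σ c e ℕ.* containing a (c ℕ.+ (c ∸ e))) (List.upTo (suc c))
  σ-relation a c a≤n = ℕP.*-cancelʳ-≡ _ _ K {{ℕ.>-nonZero (ℕP.*-mono-≤ (bases-pos 1<q a) (bases-pos 1<q c))}} (begin
    sumL (λ b → σ a b ℕ.* gauss b c) (List.upTo (suc a)) ℕ.* K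
      ≡⟨ sym (sumL-*ʳ (λ b → σ a b ℕ.* gauss b c) K (List.upTo (suc a))) ⟩
    sumL (λ b → σ a b ℕ.* gauss b c ℕ.* K) (List.upTo (suc a))
      ≡⟨ sumL-cong (List.upTo (suc a)) by-outer ⟩
    sumL (λ b → tuplesWithCoreDim a b ℕ.* extensions b 0 c) (List.upTo (suc a))
      ≡⟨ double-count a c a≤n ⟩
    sumL (λ e → tuplesWithCoreDim c e ℕ.* (containing a (c ℕ.+ (c ∸ e)) ℕ.* bases a)) (List.upTo (suc c))
      ≡⟨ sumL-cong (List.upTo (suc c)) by-inner ⟩
    sumL (λ e → σ c e ℕ.* containing a (c ℕ.+ (c ∸ e)) ℕ.* K) (List.upTo (suc c))
      ≡⟨ sumL-*ʳ (λ e → σ c e ℕ.* containing a (c ℕ.+ (c ∸ e))) K (List.upTo (suc c)) ⟩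
    sumL (λ e → σ c e ℕ.* containing a (c ℕ.+ (c ∸ e))) (List.upTo (suc c)) ℕ.* K ∎)
    where
    open ≡-Reasoning
    open StableCore F n T using (tuplesWithCoreDim)
    open QArithmetic q using (extensions)
    K = bases a ℕ.* bases c
    regroup₁ : ∀ s g x y → s ℕ.* g ℕ.* (x ℕ.* y) ≡ s ℕ.* x ℕ.* (g ℕ.* y)
    regroup₁ = solve-∀
    regroup₂ : ∀ s h x y → s ℕ.* y ℕ.* (h ℕ.* x) ≡ s ℕ.* h ℕ.* (x ℕ.* y)
    regroup₂ = solve-∀
    by-outer : ∀ b → σ a b ℕ.* gauss b c ℕ.* K ≡ tuplesWithCoreDim a b ℕ.* extensions b 0 c
    by-outer b = trans (regroup₁ (σ a b) (gauss b c) (bases a) (bases c))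
                       (sym (cong₂ ℕ._*_ (tuplesWithCoreDim≡σ*bases a b) (extensions≡gauss*bases 1≤q b c)))
    by-inner : ∀ e → tuplesWithCoreDim c e ℕ.* (containing a (c ℕ.+ (c ∸ e)) ℕ.* bases a)
                       ≡ σ c e ℕ.* containing a (c ℕ.+ (c ∸ e)) ℕ.* K
    by-inner e = trans (cong (ℕ._* (containing a (c ℕ.+ (c ∸ e)) ℕ.* bases a)) (tuplesWithCoreDim≡σ*bases c e))
                       (regroup₂ (σ c e) (containing a (c ℕ.+ (c ∸ e))) (bases a) (bases c))

  above : ℕ → (ℕ → ℕ) → ℕ → ℕ
  above c g b = if does (c ℕ.<? b) then g b else 0

  sumL-split-at : ∀ B c (g : ℕ → ℕ) → c < B → (∀ b → b < c → g b ≡ 0) →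
    sumL g (List.upTo B) ≡ g c ℕ.+ sumL (above c g) (List.upTo B)
  sumL-split-at B c g c<B below = trans (sumL-cong (List.upTo B) pointwise)
    (trans (sumL-+ (λ b → 𝟙 (does (c ℕ.≟ b)) ℕ.* g b) (above c g) (List.upTo B))
           (cong (ℕ._+ sumL (above c g) (List.upTo B)) (sumL-upTo-point B c g c<B)))
    where
    pointwise : ∀ b → g b ≡ 𝟙 (does (c ℕ.≟ b)) ℕ.* g b ℕ.+ above c g b
    pointwise b with ℕP.<-cmp c b
    ... | tri< c<b c≢b _ = sym (cong₂ ℕ._+_ (cong (λ t → 𝟙 t ℕ.* g b) (dec-false (c ℕ.≟ b) c≢b))
                                          (cong (if_then g b else 0) (dec-true (c ℕ.<? b) c<b)))
    ... | tri≈ _ refl _  = sym (trans (cong₂ ℕ._+_ (cong (λ t → 𝟙 t ℕ.* g b) (dec-true (c ℕ.≟ b) refl))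
                                                (cong (if_then g b else 0) (dec-false (c ℕ.<? b) (ℕP.<-irrefl refl))))
                                      (trans (ℕP.+-identityʳ _) (ℕP.*-identityˡ (g b))))
    ... | tri> _ c≢b b<c = trans (below b b<c) (sym (cong₂ ℕ._+_ (cong (λ t → 𝟙 t ℕ.* g b) (dec-false (c ℕ.≟ b) c≢b))
                                                              (cong (if_then g b else 0) (dec-false (c ℕ.<? b) (ℕP.<⇒≯ b<c)))))

  -- gauss b c vanishes for b < c and equals 1 for b = c, isolating σ a c in σ-relation.
  σ-recursion : ∀ a c → c ≤ a → a ≤ n →
    σ a c ℕ.+ sumL (above c (λ b → σ a b ℕ.* gauss b c)) (List.upTo (suc a))
      ≡ sumL (λ e → σ c e ℕ.* containing a (c ℕ.+ (c ∸ e))) (List.upTo (suc c))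
  σ-recursion a c c≤a a≤n = begin
    σ a c ℕ.+ sumL (above c (λ b → σ a b ℕ.* gauss b c)) (List.upTo (suc a))
      ≡⟨ cong (ℕ._+ sumL (above c (λ b → σ a b ℕ.* gauss b c)) (List.upTo (suc a)))
              (sym (trans (cong (σ a c ℕ.*_) (gauss-diag c)) (ℕP.*-identityʳ (σ a c)))) ⟩
    σ a c ℕ.* gauss c c ℕ.+ sumL (above c (λ b → σ a b ℕ.* gauss b c)) (List.upTo (suc a))
      ≡⟨ sym (sumL-split-at (suc a) c (λ b → σ a b ℕ.* gauss b c) (s≤s c≤a)
                (λ b b<c → trans (cong (σ a b ℕ.*_) (gauss-vanishes b c b<c)) (ℕP.*-zeroʳ (σ a b)))) ⟩
    sumL (λ b → σ a b ℕ.* gauss b c) (List.upTo (suc a))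
      ≡⟨ σ-relation a c a≤n ⟩
    sumL (λ e → σ c e ℕ.* containing a (c ℕ.+ (c ∸ e))) (List.upTo (suc c)) ∎
    where open ≡-Reasoning

module CoefficientPolynomials (n : ℕ) where
  open IntegerPolynomials
  open import Data.Integer using (+_)

  containingₚ : ℕ → ℕ → Poly
  containingₚ a s = if does (s ℕ.≤? a) then gaussₚ (n ∸ s) (a ∸ s) else []

  δₚ : ℕ → ℕ → Poly
  δₚ a j = if does (a ℕ.≟ j) then constₚ (+ 1) else []

  μ : ℕ → ℕ → ℕ
  μ a c = a ℕ.* suc a ℕ.+ (a ∸ c)

  -- With enough fuel, coeff f a c j is the polynomial multiplying X_j in σ a c: σ a a = X_a, and
  -- for c < a, σ-recursion expresses σ a c through σ c e (smaller a) and σ a b for b > c (smaller a ∸ c).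
  mutual
    coeff : ℕ → ℕ → ℕ → ℕ → Poly
    coeff zero    a c j = []
    coeff (suc f) a c j = coeffStep f a c j (a ℕ.≤? c)

    coeffStep : ℕ → (a c : ℕ) → ℕ → Dec (a ≤ c) → Poly
    coeffStep f a c j (yes _) = δₚ a j
    coeffStep f a c j (no _)  =
      sumₚ (λ e → containingₚ a (c ℕ.+ (c ∸ e)) *ₚ coeff f c e j) (List.upTo (suc c))
      +ₚ -ₚ sumₚ (λ b → coeffAbove f a c j b (c ℕ.<? b)) (List.upTo (suc a))

    coeffAbove : ℕ → ℕ → (c : ℕ) → ℕ → (b : ℕ) → Dec (c < b) → Poly
    coeffAbove f a c j b (yes _) = gaussₚ b c *ₚ coeff f a b j
    coeffAbove f a c j b (no _)  = []

  μ-inner< : ∀ a c e → c < a → e ≤ c → μ c e < μ a c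
  μ-inner< a c e c<a e≤c = ℕP.<-≤-trans (s≤s (ℕP.+-monoʳ-≤ (c ℕ.* suc c) (ℕP.m∸n≤m c e)))
    (ℕP.≤-trans (ℕP.≤-reflexive (cong suc (ℕP.+-comm (c ℕ.* suc c) c)))
      (ℕP.≤-trans (ℕP.*-mono-≤ c<a (ℕP.m≤n⇒m≤1+n c<a)) (ℕP.m≤m+n (a ℕ.* suc a) (a ∸ c))))

  μ-above< : ∀ a c b → c < b → b ≤ a → μ a b < μ a c
  μ-above< a c b c<b b≤a = ℕP.+-monoʳ-< (a ℕ.* suc a) (ℕP.∸-monoʳ-< c<b b≤a)

module CoefficientEvaluation (F : FiniteField) (n : ℕ) (T : LinAlg.Matrix F n) (top : ℕ) (top≤n : top ≤ n) where
  open import Data.Integer as ℤ using (ℤ; +_; -_)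
  import Data.Integer.Properties as ℤP
  open import Data.Integer.Tactic.RingSolver using (solve-∀)
  open ListSums using (sumL)
  open IntegerSums
  open IntegerPolynomials
  open CoefficientPolynomials n
  open FieldVectors F using (q)
  open Evaluation q
  open QArithmetic q using (gauss)
  open ContainingSubspaces F n using (containing)
  open StableCore F n T using (σ)
  open SigmaRecursion F n T using (above; σ-recursion)

  V : (ℕ → Poly) → ℤ
  V g = sumLℤ (λ j → eval (g j) ℤ.* + σ j j) (List.upTo (suc top))

  V-+ₚ : ∀ g h → V (λ j → g j +ₚ h j) ≡ V g ℤ.+ V h
  V-+ₚ g h = trans (sumLℤ-cong (List.upTo (suc top)) (λ j → trans (cong (ℤ._* + σ j j) (eval-+ₚ (g j) (h j)))
                                                                   (ℤP.*-distribʳ-+ (+ σ j j) (eval (g j)) (eval (h j)))))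
                   (sumLℤ-+ (λ j → eval (g j) ℤ.* + σ j j) (λ j → eval (h j) ℤ.* + σ j j) (List.upTo (suc top)))

  V--ₚ : ∀ g → V (λ j → -ₚ g j) ≡ - V g
  V--ₚ g = trans (sumLℤ-cong (List.upTo (suc top)) (λ j → trans (cong (ℤ._* + σ j j) (eval--ₚ (g j)))
                                                                 (sym (ℤP.neg-distribˡ-* (eval (g j)) (+ σ j j)))))
                 (sumLℤ-neg (λ j → eval (g j) ℤ.* + σ j j) (List.upTo (suc top)))

  V-*ₚ : ∀ p g → V (λ j → p *ₚ g j) ≡ eval p ℤ.* V g
  V-*ₚ p g = trans (sumLℤ-cong (List.upTo (suc top)) (λ j → trans (cong (ℤ._* + σ j j) (eval-*ₚ p (g j)))
                                                                   (ℤP.*-assoc (eval p) (eval (g j)) (+ σ j j))))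
                   (sumLℤ-*ˡ (eval p) (λ j → eval (g j) ℤ.* + σ j j) (List.upTo (suc top)))

  V-sumₚ : ∀ (G : ℕ → ℕ → Poly) (L : List ℕ) → V (λ j → sumₚ (λ e → G e j) L) ≡ sumLℤ (λ e → V (G e)) L
  V-sumₚ G L = trans (sumLℤ-cong (List.upTo (suc top)) (λ j → trans (cong (ℤ._* + σ j j) (eval-sumₚ (λ e → G e j) L))
                                                                     (sym (sumLℤ-*ʳ (λ e → eval (G e j)) (+ σ j j) L))))
                     (sumLℤ-swap (λ j e → eval (G e j) ℤ.* + σ j j) (List.upTo (suc top)) L)

  V-δₚ : ∀ a → a ≤ top → V (δₚ a) ≡ + σ a a
  V-δₚ a a≤top = trans (sumLℤ-cong (List.upTo (suc top)) (λ j → at j (a ℕ.≟ j)))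
                       (sumLℤ-upTo-point (suc top) a (λ j → + σ j j) (s≤s a≤top))
    where
    at : ∀ j (a≟j : Dec (a ≡ j)) → eval (if does a≟j then constₚ (+ 1) else []) ℤ.* + σ j j ≡ (if does a≟j then + σ j j else + 0)
    at j (yes _) = trans (cong (ℤ._* + σ j j) (eval-constₚ (+ 1))) (ℤP.*-identityˡ (+ σ j j))
    at j (no _)  = refl

  eval-containingₚ : ∀ a s → eval (containingₚ a s) ≡ + containing a s
  eval-containingₚ a s with does (s ℕ.≤? a)
  ... | true  = eval-gaussₚ (n ∸ s) (a ∸ s)
  ... | false = refl

  V-coeffAbove : ∀ f a c b (c<?b : Dec (c < b)) →
    V (λ j → coeffAbove f a c j b c<?b) ≡ (if does c<?b then eval (gaussₚ b c) ℤ.* V (coeff f a b) else + 0)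
  V-coeffAbove f a c b (yes _) = V-*ₚ (gaussₚ b c) (coeff f a b)
  V-coeffAbove f a c b (no _)  = sumLℤ-zero (List.upTo (suc top))

  V-coeffStep : ∀ f a c (a≰c : ¬ a ≤ c) → V (λ j → coeffStep f a c j (no a≰c))
    ≡ sumLℤ (λ e → eval (containingₚ a (c ℕ.+ (c ∸ e))) ℤ.* V (coeff f c e)) (List.upTo (suc c))
      ℤ.- sumLℤ (λ b → V (λ j → coeffAbove f a c j b (c ℕ.<? b))) (List.upTo (suc a))
  V-coeffStep f a c a≰c = trans (V-+ₚ inner (λ j → -ₚ outer j)) (cong₂ (λ x y → x ℤ.+ y) inner≡ (trans (V--ₚ outer) (cong -_ outer≡)))
    where
    inner outer : ℕ → Poly
    inner j = sumₚ (λ e → containingₚ a (c ℕ.+ (c ∸ e)) *ₚ coeff f c e j) (List.upTo (suc c))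
    outer j = sumₚ (λ b → coeffAbove f a c j b (c ℕ.<? b)) (List.upTo (suc a))
    inner≡ = trans (V-sumₚ (λ e j → containingₚ a (c ℕ.+ (c ∸ e)) *ₚ coeff f c e j) (List.upTo (suc c)))
                   (sumLℤ-cong (List.upTo (suc c)) (λ e → V-*ₚ (containingₚ a (c ℕ.+ (c ∸ e))) (coeff f c e)))
    outer≡ = V-sumₚ (λ b j → coeffAbove f a c j b (c ℕ.<? b)) (List.upTo (suc a))

  +-difference : ∀ {x y z} → x ℕ.+ y ≡ z → + x ≡ + z ℤ.- + y
  +-difference {x} {y} refl = sym (trans (cong (ℤ._- + y) (ℤP.pos-+ x y)) (cancel (+ x) (+ y)))
    where
    cancel : ∀ x y → (x ℤ.+ y) ℤ.- y ≡ x
    cancel = solve-∀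

  module _ (f : ℕ) (ih : ∀ a c → a ≤ top → c ≤ a → μ a c < f → + σ a c ≡ V (coeff f a c)) where

    inner≡ : ∀ a c → c < a → a ≤ top → μ a c ≤ f →
      + sumL (λ e → σ c e ℕ.* containing a (c ℕ.+ (c ∸ e))) (List.upTo (suc c))
        ≡ sumLℤ (λ e → eval (containingₚ a (c ℕ.+ (c ∸ e))) ℤ.* V (coeff f c e)) (List.upTo (suc c))
    inner≡ a c c<a a≤top μ≤f = trans (+-sumL _ (List.upTo (suc c))) (sumLℤ-cong∈ (List.upTo (suc c)) λ e e∈ →
      let e≤c = ℕP.≤-pred (∈-upTo⁻ e∈) in begin
      + (σ c e ℕ.* containing a (c ℕ.+ (c ∸ e)))        ≡⟨ ℤP.pos-* (σ c e) _ ⟩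
      + σ c e ℤ.* + containing a (c ℕ.+ (c ∸ e))        ≡⟨ ℤP.*-comm (+ σ c e) _ ⟩
      + containing a (c ℕ.+ (c ∸ e)) ℤ.* + σ c e        ≡⟨ cong₂ ℤ._*_ (sym (eval-containingₚ a (c ℕ.+ (c ∸ e))))
                                                              (ih c e (ℕP.≤-trans (ℕP.<⇒≤ c<a) a≤top) e≤c
                                                                  (ℕP.<-≤-trans (μ-inner< a c e c<a e≤c) μ≤f)) ⟩
      eval (containingₚ a (c ℕ.+ (c ∸ e))) ℤ.* V (coeff f c e) ∎)
      where open ≡-Reasoning

    above≡ : ∀ a c → a ≤ top → μ a c ≤ f →
      + sumL (above c (λ b → σ a b ℕ.* gauss b c)) (List.upTo (suc a))
        ≡ sumLℤ (λ b → V (λ j → coeffAbove f a c j b (c ℕ.<? b))) (List.upTo (suc a))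
    above≡ a c a≤top μ≤f = trans (+-sumL _ (List.upTo (suc a))) (sumLℤ-cong∈ (List.upTo (suc a)) λ b b∈ →
      trans (at b (ℕP.≤-pred (∈-upTo⁻ b∈)) (c ℕ.<? b)) (sym (V-coeffAbove f a c b (c ℕ.<? b))))
      where
      open ≡-Reasoning
      at : ∀ b → b ≤ a → (c<?b : Dec (c < b)) →
        + (if does c<?b then σ a b ℕ.* gauss b c else 0) ≡ (if does c<?b then eval (gaussₚ b c) ℤ.* V (coeff f a b) else + 0)
      at b b≤a (no _)    = refl
      at b b≤a (yes c<b) = begin
        + (σ a b ℕ.* gauss b c)                 ≡⟨ trans (ℤP.pos-* (σ a b) (gauss b c)) (ℤP.*-comm (+ σ a b) _) ⟩
        + gauss b c ℤ.* + σ a b                 ≡⟨ cong₂ ℤ._*_ (sym (eval-gaussₚ b c))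
                                                           (ih a b a≤top b≤a (ℕP.<-≤-trans (μ-above< a c b c<b b≤a) μ≤f)) ⟩
        eval (gaussₚ b c) ℤ.* V (coeff f a b) ∎

  σ≡V : ∀ f a c → a ≤ top → c ≤ a → μ a c < f → + σ a c ≡ V (coeff f a c)
  σ≡V (suc f) a c a≤top c≤a μ<1+f = step (a ℕ.≤? c)
    where
    open ≡-Reasoning
    step : (a≤?c : Dec (a ≤ c)) → + σ a c ≡ V (λ j → coeffStep f a c j a≤?c)
    step (yes a≤c) rewrite ℕP.≤-antisym c≤a a≤c = sym (V-δₚ a a≤top)
    step (no a≰c) = begin
      + σ a c
        ≡⟨ +-difference (σ-recursion a c c≤a (ℕP.≤-trans a≤top top≤n)) ⟩
      + sumL (λ e → σ c e ℕ.* containing a (c ℕ.+ (c ∸ e))) (List.upTo (suc c))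
        ℤ.- + sumL (above c (λ b → σ a b ℕ.* gauss b c)) (List.upTo (suc a))
        ≡⟨ cong₂ ℤ._-_ (inner≡ f (σ≡V f) a c (ℕP.≰⇒> a≰c) a≤top (ℕP.≤-pred μ<1+f))
                       (above≡ f (σ≡V f) a c a≤top (ℕP.≤-pred μ<1+f)) ⟩
      sumLℤ (λ e → eval (containingₚ a (c ℕ.+ (c ∸ e))) ℤ.* V (coeff f c e)) (List.upTo (suc c))
        ℤ.- sumLℤ (λ b → V (λ j → coeffAbove f a c j b (c ℕ.<? b))) (List.upTo (suc a))
        ≡⟨ sym (V-coeffStep f a c a≰c) ⟩
      V (λ j → coeffStep f a c j (no a≰c)) ∎

module SubspaceCounts (F : FiniteField) (n : ℕ) (T : LinAlg.Matrix F n) where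
  open ListSums
  open FieldVectors F
  open Subspaces F
  open TupleCounting F
  open StableCore F n T
  open QArithmetic q using (bases; bases-pos)

  private
    count-by-bases : ∀ a (P : SubsetV n → Set) N → HasCount P N → (∀ W → P W → IsSubspace W × HasDim W a) →
      (∀ W W′ → W ≈ˢ W′ → P W → P W′) → ∀ b → (∀ w → independent? w ≡ true → HasCoreDim b w ≡ true ⇔ P (span w)) →
      N ≡ σ a b
    count-by-bases a P N counted subspace P-≈ b ⇔P = ℕP.*-cancelʳ-≡ N (σ a b) (bases a) {{ℕ.>-nonZero (bases-pos 1<q a)}}
      (trans (sym (HasCount⇒count a P N counted subspace P-≈ (HasCoreDim b) ⇔P)) (tuplesWithCoreDim≡σ*bases a b))

  HasCoreDim⇔ : ∀ {a} b (w : Vec (Vector n) a) → HasCoreDim b w ≡ true ⇔ HasDim (core w) b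
  HasCoreDim⇔ b w = mk⇔ (λ e → subst (HasDim (core w)) (does-true⁻ (coreDim w ℕ.≟ b) e) (coreDim-HasDim w))
                        (λ hd → dec-true (coreDim w ℕ.≟ b) (dim-unique (core w) (core-isSubspace w) b hd))

  HasCount⇒≡σ : ∀ a b N → HasCount (λ W → IsSubspace W × HasDim W a × HasDim (W ∩ˢ preimage T W) b) N → N ≡ σ a b
  HasCount⇒≡σ a b N counted = count-by-bases a _ N counted (λ W p → proj₁ p , proj₁ (proj₂ p)) P-≈ b ⇔P
    where
    P-≈ : ∀ W W′ → W ≈ˢ W′ → _ → _
    P-≈ W W′ e (S , d , d∩) = IsSubspace-≈ W W′ e S , HasDim-≈ W W′ a e d
      , HasDim-≈ (W ∩ˢ preimage T W) (W′ ∩ˢ preimage T W′) b (λ v → cong₂ _∧_ (e v) (e (apply T v))) d∩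
    ⇔P : ∀ w → independent? w ≡ true → _
    ⇔P w w-indep = mk⇔ (λ e → span-isSubspace w , span-HasDim w (independent?-sound w w-indep) , Equivalence.to (HasCoreDim⇔ b w) e)
                       (λ (_ , _ , d∩) → Equivalence.from (HasCoreDim⇔ b w) d∩)

  -- Invariance means core w = span w; comparing cardinalities, this is full dimension of core w.
  IsInvariant⇔core-full : ∀ {a} (w : Vec (Vector n) a) → Independent w → IsInvariant T (span w) ⇔ HasDim (core w) a
  IsInvariant⇔core-full {a} w w-indep = mk⇔
    (λ inv → HasDim-≈ (span w) (core w) a (λ v → core-full inv v) (span-HasDim w w-indep))
    (λ hd v v∈ → apply-core⊆span w v (count-≡⇒⊇ (core w) (span w) (vectors n) (core⊆span w)
                    (trans (card-HasDim (core w) a hd) (sym (card-span w w-indep))) v (∈-vectors v) v∈))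
    where
    core-full : IsInvariant T (span w) → ∀ v → span w v ≡ core w v
    core-full inv v = bool-ext (λ v∈ → ∧-true⁺ v∈ (inv v v∈)) (core⊆span w v)

  HasCount-invariant⇒≡σ : ∀ j X → HasCount (λ W → IsSubspace W × HasDim W j × IsInvariant T W) X → X ≡ σ j j
  HasCount-invariant⇒≡σ j X counted = count-by-bases j _ X counted (λ W p → proj₁ p , proj₁ (proj₂ p)) P-≈ j ⇔P
    where
    P-≈ : ∀ W W′ → W ≈ˢ W′ → _ → _
    P-≈ W W′ e (S , d , inv) = IsSubspace-≈ W W′ e S , HasDim-≈ W W′ j e d
      , λ v v∈ → trans (sym (e (apply T v))) (inv v (trans (e v) v∈))
    ⇔P : ∀ w → independent? w ≡ true → _
    ⇔P w w-indep = mk⇔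
      (λ e → span-isSubspace w , span-HasDim w w-indep′ , Equivalence.from (IsInvariant⇔core-full w w-indep′) (Equivalence.to (HasCoreDim⇔ j w) e))
      (λ (_ , _ , inv) → Equivalence.from (HasCoreDim⇔ j w) (Equivalence.to (IsInvariant⇔core-full w w-indep′) inv))
      where w-indep′ = independent?-sound w w-indep

open import Data.Integer using (+_; _*_)

open LinAlg using (Matrix; HasCount; IsSubspace; HasDim; _∩ˢ_; preimage; IsInvariant)

proposition3p3 : (n a b : ℕ) → b ≤ a → a ≤ n →
    Σ (Fin (suc a) → Poly) λ p →
      (F : FiniteField) (T : Matrix F n) (N : ℕ) (X : Fin (suc a) → ℕ) →
      HasCount F (λ W → IsSubspace F W × HasDim F W a × HasDim F (_∩ˢ_ F W (preimage F T W)) b) N →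
      ((j : Fin (suc a)) → HasCount F (λ W → IsSubspace F W × HasDim F W (toℕ j) × IsInvariant F T W) (X j)) →
      + N ≡ sumℤ (λ j → evalPoly (p j) (+ FiniteField.size F) * + X j)
proposition3p3 n a b b≤a a≤n = (λ j → coeff fuel a b (toℕ j)) , counts
  where
  open CoefficientPolynomials n using (coeff; μ)
  fuel = suc (μ a b)
  counts : (F : FiniteField) (T : Matrix F n) (N : ℕ) (X : Fin (suc a) → ℕ) →
    HasCount F (λ W → IsSubspace F W × HasDim F W a × HasDim F (_∩ˢ_ F W (preimage F T W)) b) N →
    ((j : Fin (suc a)) → HasCount F (λ W → IsSubspace F W × HasDim F W (toℕ j) × IsInvariant F T W) (X j)) →
    + N ≡ sumℤ (λ j → evalPoly (coeff fuel a b (toℕ j)) (+ FiniteField.size F) * + X j)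
  counts F T N X N-counts X-counts = begin
    + N
      ≡⟨ cong +_ (HasCount⇒≡σ a b N N-counts) ⟩
    + σ a b
      ≡⟨ σ≡V fuel a b ℕP.≤-refl b≤a ℕP.≤-refl ⟩
    V (coeff fuel a b)
      ≡⟨ sym (sumℤ≡sumLℤ-upTo (suc a) (λ j → eval (coeff fuel a b j) * + σ j j)) ⟩
    sumℤ {suc a} (λ j → eval (coeff fuel a b (toℕ j)) * + σ (toℕ j) (toℕ j))
      ≡⟨ sumℤ-cong (suc a) (λ j → eval (coeff fuel a b (toℕ j)) * + σ (toℕ j) (toℕ j))
                           (λ j → eval (coeff fuel a b (toℕ j)) * + X j) (λ j → cong (λ x → eval (coeff fuel a b (toℕ j)) * + x)
                                          (sym (HasCount-invariant⇒≡σ (toℕ j) (X j) (X-counts j)))) ⟩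
    sumℤ (λ j → evalPoly (coeff fuel a b (toℕ j)) (+ FiniteField.size F) * + X j) ∎
    where
    open ≡-Reasoning
    open StableCore F n T using (σ)
    open SubspaceCounts F n T using (HasCount⇒≡σ; HasCount-invariant⇒≡σ)
    open CoefficientEvaluation F n T a a≤n using (V; σ≡V)
    open IntegerPolynomials.Evaluation (FiniteField.size F) using (eval)
    open IntegerSums using (sumℤ≡sumLℤ-upTo; sumℤ-cong)
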